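{- Let $a,b\in\mathbb{Z}[i]\setminus\{0\}$ have Gauss remainder $r\neq0$. If $\Im(u_b b)\,\Im(u_r r)<0$, $\phi_{\mathbb{Z}[i]}(r)\geq\phi_{\mathbb{Z}[i]}(b)=n$, $m(b)<\ell_\infty(r)<m(b)+m(r)$, and $\ell_\infty(b)-m(r)\leq w_{n-1}-2^{v_2(b)+1}$, then $\phi_{\mathbb{Z}[i]}\left(r-\frac{i u_b}{s(r)u_r}b\right)<\phi_{\mathbb{Z}[i]}(b)$.
   Context: $\mathbb{Z}[i]$ has units $\pm1,\pm i$ and norm $\mathrm{Nm}(x+yi)=x^2+y^2$. A function $f:\mathbb{Z}[i]\setminus\{0\}\to W$ ($W$ a well-ordered set having $\mathbb{N}$ as an initial segment) is Euclidean if for all nonzero $a,b$ there exist $q,r$ with $a=qb+r$ and either $r=0$ or $f(r)<f(b)$. $\phi_{\mathbb{Z}[i]}$ is the minimal Euclidean function, the pointwise minimum of all Euclidean functions (equivalently, the minimal $n$ such that $z=\sum_{j=0}^n u_j(1+i)^j$ with $u_j\in\{0,\pm1,\pm i\}$, $u_n\ne0$). Gauss remainder: write $a\bar b/\mathrm{Nm}(b)=\alpha+\beta i$; let $\lfloor x\rceil=\lfloor x\rfloor$ if $0\le x-\lfloor x\rfloor\le1/2$ and $\lceil x\rceil$ otherwise; $q=\lfloor\alpha\rceil+\lfloor\beta\rceil i$ and $r=a-qb$. $\ell_\infty(x+yi)=\max(|x|,|y|)$, $m(x+yi)=\min(|x|,|y|)$. For $z\ne0$, $u_z$ is the unique unit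 with $\Re(u_z z)=\ell_\infty(z)$ if $\ell_\infty(z)\ne m(z)$, and the unique unit with $u_z z=\ell_\infty(z)(1+i)$ if $\ell_\infty(z)=m(z)$. $s(r)=\mathrm{sgn}(\Im(u_r r))$ (nonzero under the hypotheses). $v_2(z)$ is the largest $j$ with $2^j\mid z$ in $\mathbb{Z}[i]$. For integers $k$, $w_{2k}=3\cdot2^k$, $w_{2k+1}=4\cdot2^k$ ($w_0=3,w_1=4,w_2=6,\dots$). -}

module Defs where

open import Data.Nat as ℕ using (ℕ; zero; suc; _⊔_; _⊓_; _^_; _≤ᵇ_)
open import Data.Integer as ℤ using (ℤ; +_; ∣_∣; _/ℕ_; _%ℕ_)
open import Data.Bool using (if_then_else_)
open import Data.Product using (Σ; _×_; _,_)
open import Data.Sum using (_⊎_)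
open import Data.Vec using (Vec; []; _∷_; last)
open import Relation.Binary.PropositionalEquality using (_≡_; _≢_)
open import Relation.Nullary using (¬_)

record 𝔾 : Set where
  constructor mk
  field
    re : ℤ
    im : ℤ
open 𝔾 public

infixl 6 _+ᵍ_ _-ᵍ_
infixl 7 _*ᵍ_

_+ᵍ_ : 𝔾 → 𝔾 → 𝔾
mk a b +ᵍ mk c d = mk (a ℤ.+ c) (b ℤ.+ d)

-ᵍ_ : 𝔾 → 𝔾
-ᵍ mk a b = mk (ℤ.- a) (ℤ.- b)

_-ᵍ_ : 𝔾 → 𝔾 → 𝔾
x -ᵍ y = x +ᵍ (-ᵍ y)

_*ᵍ_ : 𝔾 → 𝔾 → 𝔾
mk a b *ᵍ mk c d = mk (a ℤ.* c ℤ.- b ℤ.* d) (a ℤ.* d ℤ.+ b ℤ.* c)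

conj : 𝔾 → 𝔾
conj (mk a b) = mk a (ℤ.- b)

0ᵍ 1ᵍ iᵍ 1+i : 𝔾
0ᵍ = mk (+ 0) (+ 0)
1ᵍ = mk (+ 1) (+ 0)
iᵍ = mk (+ 0) (+ 1)
1+i = mk (+ 1) (+ 1)

ι : ℤ → 𝔾
ι n = mk n (+ 0)

Nm : 𝔾 → ℕ
Nm (mk x y) = ∣ x ∣ ℕ.* ∣ x ∣ ℕ.+ ∣ y ∣ ℕ.* ∣ y ∣

ℓ∞ : 𝔾 → ℕ
ℓ∞ (mk x y) = ∣ x ∣ ⊔ ∣ y ∣

mᵍ : 𝔾 → ℕ
mᵍ (mk x y) = ∣ x ∣ ⊓ ∣ y ∣

IsUnit : 𝔾 → Set
IsUnit u = (u ≡ 1ᵍ ⊎ u ≡ -ᵍ 1ᵍ) ⊎ (u ≡ iᵍ ⊎ u ≡ -ᵍ iᵍ)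

_∣ᵍ_ : 𝔾 → 𝔾 → Set
d ∣ᵍ z = Σ 𝔾 λ q → z ≡ q *ᵍ d

V₂ : 𝔾 → ℕ → Set
V₂ z j = (ι (+ (2 ^ j)) ∣ᵍ z) × ¬ (ι (+ (2 ^ suc j)) ∣ᵍ z)

IsUz : 𝔾 → 𝔾 → Set
IsUz z u = IsUnit u
  × (ℓ∞ z ≢ mᵍ z → re (u *ᵍ z) ≡ + ℓ∞ z)
  × (ℓ∞ z ≡ mᵍ z → u *ᵍ z ≡ mk (+ ℓ∞ z) (+ ℓ∞ z))

sgn : ℤ → ℤ
sgn (+ zero) = + 0
sgn (+ suc _) = + 1
sgn ℤ.-[1+ _ ] = ℤ.- (+ 1)

data Digit : Set where
  d0 d1 d-1 di d-i : Digit

digit : Digit → 𝔾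
digit d0 = 0ᵍ
digit d1 = 1ᵍ
digit d-1 = -ᵍ 1ᵍ
digit di = iᵍ
digit d-i = -ᵍ iᵍ

-- eval (u₀ ∷ u₁ ∷ … ∷ uₙ ∷ []) = Σ_j u_j (1+i)^j
eval : ∀ {n} → Vec Digit n → 𝔾
eval [] = 0ᵍ
eval (d ∷ ds) = digit d +ᵍ 1+i *ᵍ eval ds

HasRep : 𝔾 → ℕ → Set
HasRep z n = Σ (Vec Digit (suc n)) λ ds → (last ds ≢ d0) × (eval ds ≡ z)

Phi : 𝔾 → ℕ → Set
Phi z n = HasRep z n × (∀ k → k ℕ.< n → ¬ HasRep z k)

-- ⌊x⌉ for x = p / N (N > 0): floor if frac(x) ≤ 1/2, ceiling otherwise
roundDiv : ℤ → ℕ → ℤ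
roundDiv p zero = + 0
roundDiv p (suc k) =
  if 2 ℕ.* (p %ℕ suc k) ≤ᵇ suc k then p /ℕ suc k else (p /ℕ suc k) ℤ.+ + 1

gaussQuot : 𝔾 → 𝔾 → 𝔾
gaussQuot a b = let c = a *ᵍ conj b in
  mk (roundDiv (re c) (Nm b)) (roundDiv (im c) (Nm b))

gaussRem : 𝔾 → 𝔾 → 𝔾
gaussRem a b = a -ᵍ gaussQuot a b *ᵍ b

-- w_k for k ≥ 0: w_{2k} = 3·2^k, w_{2k+1} = 4·2^k
w : ℕ → ℕ
w zero = 3
w (suc zero) = 4
w (suc (suc k)) = 2 ℕ.* w k

-- W n = w_{n-1}  (with w_{-1} = 4·2^{-1} = 2)
W : ℕ → ℕ
W zero = 2
W (suc j) = w j

{-# OPTIONS --safe #-}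

-- Normalised by their units, u_b b = X − s μ i and u_r r = P + s c i, where X = ℓ∞ b, μ = m(b),
-- P = ℓ∞ r, c = m(r) and s = ±1; for the new remainder Z this gives u_r Z = (P − μ) + s (c − X) i.
-- The Gauss remainder satisfies 2 ℓ∞ (r b̄) ≤ N(b), that is 2 (P μ + c X) ≤ X² + μ², and together
-- with μ < P < μ + c this forces P + c < X; hence ℓ∞ Z = X − c and ℓ₁ Z = (P − μ) + (X − c) < X.
-- Expansions in base 1 + i are governed by boxes: a nonzero z with digits u₀ … u_m satisfies
-- ℓ∞ z + 2 ≤ w_m and ℓ₁ z + 3 ≤ w_{m+1}, conversely every z with 2 ∤ z in this box has such an
-- expansion, and multiplying by 2ᵗ scales both bounds by 2ᵗ. Write Z = 2ᵗ g with 2 ∤ g and let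
-- j = v₂(b). If t ≤ j, the bound on X − c and the box of b put Z in the box of index n − 1. If t > j,
-- then r = 2ʲ g′ with 2 ∤ g′ lies in that box as well, contradicting φ(r) ≥ n.

module Submission where

open import Defs
open import Data.Nat as ℕ
  using (ℕ; zero; suc; _+_; _*_; _∸_; _^_; _≤_; _<_; _⊔_; _⊓_; z≤n; s≤s; _≤?_)
open import Data.Nat.Properties
open import Data.Nat.Divisibility as ℕ∣ using (_∣_; divides; _∣?_)
open import Data.Nat.Induction using (<-rec)
open import Data.Integer as ℤ using (ℤ; +_; -[1+_]; ∣_∣)
import Data.Integer.Properties as ℤP
import Data.Integer.Divisibility.Signed as ℤ∣
import Data.Integer.DivMod as DM
import Data.Integer.Tactic.RingSolver as ℤ-Solver
import Data.Nat.Tactic.RingSolver as ℕ-Solver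
open import Tactic.RingSolver using (solve-∀)
open import Tactic.RingSolver.Core.AlmostCommutativeRing using (AlmostCommutativeRing)
open import Relation.Binary.PropositionalEquality
open import Algebra.Structures {A = 𝔾} _≡_ using (IsCommutativeMonoid)
open import Algebra.Structures.Biased {A = 𝔾} _≡_
  using (isCommutativeMonoidˡ; isCommutativeSemiringˡ)
open import Data.Bool using (true; false; T)
open import Data.Empty using (⊥; ⊥-elim)
open import Data.Product using (Σ; ∃; _×_; _,_; proj₁; proj₂; uncurry)
open import Data.Sum using (_⊎_; inj₁; inj₂)
open import Data.Unit using (tt)
open import Data.Vec using (Vec; []; _∷_; last)
import Data.Vec as Vec
open import Function using (_∘_)
open import Relation.Nullary using (¬_; Dec; yes; no; dec⇒maybe)
open import Relation.Nullary.Decidable using (map′; _×-dec_; _⊎-dec_; ¬?)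

-- ℤ[i] as a commutative ring

+ᵍ-assoc : ∀ x y z → (x +ᵍ y) +ᵍ z ≡ x +ᵍ (y +ᵍ z)
+ᵍ-assoc (mk a b) (mk c d) (mk e f) = cong₂ mk (ℤP.+-assoc a c e) (ℤP.+-assoc b d f)

+ᵍ-comm : ∀ x y → x +ᵍ y ≡ y +ᵍ x
+ᵍ-comm (mk a b) (mk c d) = cong₂ mk (ℤP.+-comm a c) (ℤP.+-comm b d)

+ᵍ-identityˡ : ∀ x → 0ᵍ +ᵍ x ≡ x
+ᵍ-identityˡ (mk a b) = cong₂ mk (ℤP.+-identityˡ a) (ℤP.+-identityˡ b)

*ᵍ-assoc : ∀ x y z → (x *ᵍ y) *ᵍ z ≡ x *ᵍ (y *ᵍ z)
*ᵍ-assoc (mk a b) (mk c d) (mk e f) = cong₂ mk (re-assoc a b c d e f) (im-assoc a b c d e f)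
  where
  re-assoc : ∀ a b c d e f → (a ℤ.* c ℤ.- b ℤ.* d) ℤ.* e ℤ.- (a ℤ.* d ℤ.+ b ℤ.* c) ℤ.* f
                           ≡ a ℤ.* (c ℤ.* e ℤ.- d ℤ.* f) ℤ.- b ℤ.* (c ℤ.* f ℤ.+ d ℤ.* e)
  re-assoc = ℤ-Solver.solve-∀
  im-assoc : ∀ a b c d e f → (a ℤ.* c ℤ.- b ℤ.* d) ℤ.* f ℤ.+ (a ℤ.* d ℤ.+ b ℤ.* c) ℤ.* e
                           ≡ a ℤ.* (c ℤ.* f ℤ.+ d ℤ.* e) ℤ.+ b ℤ.* (c ℤ.* e ℤ.- d ℤ.* f)
  im-assoc = ℤ-Solver.solve-∀

*ᵍ-comm : ∀ x y → x *ᵍ y ≡ y *ᵍ x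
*ᵍ-comm (mk a b) (mk c d) = cong₂ mk (re-comm a b c d) (im-comm a b c d)
  where
  re-comm : ∀ a b c d → a ℤ.* c ℤ.- b ℤ.* d ≡ c ℤ.* a ℤ.- d ℤ.* b
  re-comm = ℤ-Solver.solve-∀
  im-comm : ∀ a b c d → a ℤ.* d ℤ.+ b ℤ.* c ≡ c ℤ.* b ℤ.+ d ℤ.* a
  im-comm = ℤ-Solver.solve-∀

*ᵍ-identityˡ : ∀ x → 1ᵍ *ᵍ x ≡ x
*ᵍ-identityˡ (mk a b) = cong₂ mk (re-identity a b) (im-identity a b)
  where
  re-identity : ∀ a b → + 1 ℤ.* a ℤ.- + 0 ℤ.* b ≡ a
  re-identity = ℤ-Solver.solve-∀
  im-identity : ∀ a b → + 1 ℤ.* b ℤ.+ + 0 ℤ.* a ≡ b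
  im-identity = ℤ-Solver.solve-∀

*ᵍ-distribʳ : ∀ x y z → (y +ᵍ z) *ᵍ x ≡ y *ᵍ x +ᵍ z *ᵍ x
*ᵍ-distribʳ (mk a b) (mk c d) (mk e f) = cong₂ mk (re-distrib a b c d e f) (im-distrib a b c d e f)
  where
  re-distrib : ∀ a b c d e f → (c ℤ.+ e) ℤ.* a ℤ.- (d ℤ.+ f) ℤ.* b
                             ≡ (c ℤ.* a ℤ.- d ℤ.* b) ℤ.+ (e ℤ.* a ℤ.- f ℤ.* b)
  re-distrib = ℤ-Solver.solve-∀
  im-distrib : ∀ a b c d e f → (c ℤ.+ e) ℤ.* b ℤ.+ (d ℤ.+ f) ℤ.* a
                             ≡ (c ℤ.* b ℤ.+ d ℤ.* a) ℤ.+ (e ℤ.* b ℤ.+ f ℤ.* a)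
  im-distrib = ℤ-Solver.solve-∀

*ᵍ-zeroˡ : ∀ x → 0ᵍ *ᵍ x ≡ 0ᵍ
*ᵍ-zeroˡ (mk a b) = refl

-ᵍ‿*-distribˡ : ∀ x y → (-ᵍ x) *ᵍ y ≡ -ᵍ (x *ᵍ y)
-ᵍ‿*-distribˡ (mk a b) (mk c d) = cong₂ mk (re-neg a b c d) (im-neg a b c d)
  where
  re-neg : ∀ a b c d → ℤ.- a ℤ.* c ℤ.- ℤ.- b ℤ.* d ≡ ℤ.- (a ℤ.* c ℤ.- b ℤ.* d)
  re-neg = ℤ-Solver.solve-∀
  im-neg : ∀ a b c d → ℤ.- a ℤ.* d ℤ.+ ℤ.- b ℤ.* c ≡ ℤ.- (a ℤ.* d ℤ.+ b ℤ.* c)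
  im-neg = ℤ-Solver.solve-∀

-ᵍ‿+-comm : ∀ x y → (-ᵍ x) +ᵍ (-ᵍ y) ≡ -ᵍ (x +ᵍ y)
-ᵍ‿+-comm (mk a b) (mk c d) = cong₂ mk (sym (ℤP.neg-distrib-+ a c)) (sym (ℤP.neg-distrib-+ b d))

_≟ᵍ_ : (x y : 𝔾) → Dec (x ≡ y)
mk a b ≟ᵍ mk c d with a ℤP.≟ c | b ℤP.≟ d
... | yes refl | yes refl = yes refl
... | no a≢c   | _        = no (a≢c ∘ cong re)
... | _        | no b≢d   = no (b≢d ∘ cong im)

private
  isCommutativeMonoid : ∀ {_∙_ : 𝔾 → 𝔾 → 𝔾} {e} →
    (∀ x y z → (x ∙ y) ∙ z ≡ x ∙ (y ∙ z)) → (∀ x → e ∙ x ≡ x) → (∀ x y → x ∙ y ≡ y ∙ x) →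
    IsCommutativeMonoid _∙_ e
  isCommutativeMonoid {_∙_} assoc identityˡ comm = isCommutativeMonoidˡ record
    { isSemigroup = record
      { isMagma = record { isEquivalence = isEquivalence ; ∙-cong = cong₂ _∙_ }
      ; assoc = assoc
      }
    ; identityˡ = identityˡ
    ; comm = comm
    }

-- solve-∀ 𝔾-ring proves identities in ℤ[i]; closed constants such as iᵍ and 1+i are multiplied out
-- by evaluation, so relations like i² = -1 are taken into account.
𝔾-ring : AlmostCommutativeRing _ _
𝔾-ring = record
  { Carrier = 𝔾
  ; _≈_ = _≡_
  ; _+_ = _+ᵍ_
  ; _*_ = _*ᵍ_
  ; -_ = (-ᵍ_)
  ; 0# = 0ᵍ
  ; 0≟_ = λ x → dec⇒maybe (0ᵍ ≟ᵍ x)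
  ; 1# = 1ᵍ
  ; isAlmostCommutativeRing = record
    { isCommutativeSemiring = isCommutativeSemiringˡ record
      { +-isCommutativeMonoid = isCommutativeMonoid +ᵍ-assoc +ᵍ-identityˡ +ᵍ-comm
      ; *-isCommutativeMonoid = isCommutativeMonoid *ᵍ-assoc *ᵍ-identityˡ *ᵍ-comm
      ; distribʳ = *ᵍ-distribʳ
      ; zeroˡ = *ᵍ-zeroˡ
      }
    ; -‿cong = cong (-ᵍ_)
    ; -‿*-distribˡ = -ᵍ‿*-distribˡ
    ; -‿+-comm = -ᵍ‿+-comm
    }
  }

*ᵍ-identityʳ : ∀ x → x *ᵍ 1ᵍ ≡ x
*ᵍ-identityʳ = solve-∀ 𝔾-ring

-- The ℤ solver works on syntax, so component identities are stated in the form to which _*ᵍ_ unfolds.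
iᵍ*mk : ∀ x y → iᵍ *ᵍ mk x y ≡ mk (ℤ.- y) x
iᵍ*mk x y = cong₂ mk (re-rotate x y) (im-rotate x y)
  where
  re-rotate : ∀ x y → + 0 ℤ.* x ℤ.- + 1 ℤ.* y ≡ ℤ.- y
  re-rotate = ℤ-Solver.solve-∀
  im-rotate : ∀ x y → + 0 ℤ.* y ℤ.+ + 1 ℤ.* x ≡ x
  im-rotate = ℤ-Solver.solve-∀

1+i*mk : ∀ x y → 1+i *ᵍ mk x y ≡ mk (x ℤ.- y) (x ℤ.+ y)
1+i*mk x y = cong₂ mk (re-1+i x y) (im-1+i x y)
  where
  re-1+i : ∀ x y → + 1 ℤ.* x ℤ.- + 1 ℤ.* y ≡ x ℤ.- y
  re-1+i = ℤ-Solver.solve-∀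
  im-1+i : ∀ x y → + 1 ℤ.* y ℤ.+ + 1 ℤ.* x ≡ x ℤ.+ y
  im-1+i = ℤ-Solver.solve-∀

mk*ι : ∀ x y k → mk x y *ᵍ ι k ≡ mk (x ℤ.* k) (y ℤ.* k)
mk*ι x y k = cong₂ mk (re-scale x y k) (im-scale x y k)
  where
  re-scale : ∀ x y k → x ℤ.* k ℤ.- y ℤ.* + 0 ≡ x ℤ.* k
  re-scale = ℤ-Solver.solve-∀
  im-scale : ∀ x y k → x ℤ.* + 0 ℤ.+ y ℤ.* k ≡ y ℤ.* k
  im-scale = ℤ-Solver.solve-∀

ι-* : ∀ x y → ι (x ℤ.* y) ≡ ι x *ᵍ ι y
ι-* x y = sym (mk*ι x (+ 0) y)

conj-* : ∀ x y → conj (x *ᵍ y) ≡ conj x *ᵍ conj y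
conj-* (mk a b) (mk c d) = cong₂ mk (re-conj a b c d) (im-conj a b c d)
  where
  re-conj : ∀ a b c d → a ℤ.* c ℤ.- b ℤ.* d ≡ a ℤ.* c ℤ.- ℤ.- b ℤ.* ℤ.- d
  re-conj = ℤ-Solver.solve-∀
  im-conj : ∀ a b c d → ℤ.- (a ℤ.* d ℤ.+ b ℤ.* c) ≡ a ℤ.* ℤ.- d ℤ.+ ℤ.- b ℤ.* c
  im-conj = ℤ-Solver.solve-∀

*conj≡ιNm : ∀ z → z *ᵍ conj z ≡ ι (+ Nm z)
*conj≡ιNm (mk x y) = cong₂ mk re-norm (im-norm x y)
  where
  square : ∀ x → x ℤ.* x ≡ + (∣ x ∣ * ∣ x ∣)
  square (+ n)    = sym (ℤP.pos-* n n)
  square -[1+ n ] = refl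
  re-norm : x ℤ.* x ℤ.- y ℤ.* ℤ.- y ≡ + (∣ x ∣ * ∣ x ∣ + ∣ y ∣ * ∣ y ∣)
  re-norm = begin
    x ℤ.* x ℤ.- y ℤ.* ℤ.- y  ≡⟨ sum-of-squares x y ⟩
    x ℤ.* x ℤ.+ y ℤ.* y      ≡⟨ cong₂ ℤ._+_ (square x) (square y) ⟩
    + (∣ x ∣ * ∣ x ∣) ℤ.+ + (∣ y ∣ * ∣ y ∣)  ≡⟨ ℤP.pos-+ (∣ x ∣ * ∣ x ∣) (∣ y ∣ * ∣ y ∣) ⟨
    + (∣ x ∣ * ∣ x ∣ + ∣ y ∣ * ∣ y ∣) ∎
    where
    open ≡-Reasoning
    sum-of-squares : ∀ x y → x ℤ.* x ℤ.- y ℤ.* ℤ.- y ≡ x ℤ.* x ℤ.+ y ℤ.* y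
    sum-of-squares = ℤ-Solver.solve-∀
  im-norm : ∀ x y → x ℤ.* ℤ.- y ℤ.+ y ℤ.* x ≡ + 0
  im-norm = ℤ-Solver.solve-∀

unit*conj : ∀ {u} → IsUnit u → u *ᵍ conj u ≡ 1ᵍ
unit*conj (inj₁ (inj₁ refl)) = refl
unit*conj (inj₁ (inj₂ refl)) = refl
unit*conj (inj₂ (inj₁ refl)) = refl
unit*conj (inj₂ (inj₂ refl)) = refl

conj-unit : ∀ {u} → IsUnit u → IsUnit (conj u)
conj-unit (inj₁ (inj₁ refl)) = inj₁ (inj₁ refl)
conj-unit (inj₁ (inj₂ refl)) = inj₁ (inj₂ refl)
conj-unit (inj₂ (inj₁ refl)) = inj₂ (inj₂ refl)
conj-unit (inj₂ (inj₂ refl)) = inj₂ (inj₁ refl)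

ℓ₁ : 𝔾 → ℕ
ℓ₁ (mk x y) = ∣ x ∣ + ∣ y ∣

ℓ∞-mᵍ-cases : ∀ z → (ℓ∞ z ≡ ∣ re z ∣ × mᵍ z ≡ ∣ im z ∣) ⊎ (ℓ∞ z ≡ ∣ im z ∣ × mᵍ z ≡ ∣ re z ∣)
ℓ∞-mᵍ-cases (mk x y) with ≤-total ∣ x ∣ ∣ y ∣
... | inj₁ x≤y = inj₂ (m≤n⇒m⊔n≡n x≤y , m≤n⇒m⊓n≡m x≤y)
... | inj₂ y≤x = inj₁ (m≥n⇒m⊔n≡m y≤x , m≥n⇒m⊓n≡n y≤x)

ℓ∞+mᵍ≡ℓ₁ : ∀ z → ℓ∞ z + mᵍ z ≡ ℓ₁ z
ℓ∞+mᵍ≡ℓ₁ z with ℓ∞-mᵍ-cases z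
... | inj₁ (ℓ≡ , m≡) = cong₂ _+_ ℓ≡ m≡
... | inj₂ (ℓ≡ , m≡) = trans (cong₂ _+_ ℓ≡ m≡) (+-comm ∣ im z ∣ ∣ re z ∣)

Nm≡ℓ∞²+mᵍ² : ∀ z → Nm z ≡ ℓ∞ z * ℓ∞ z + mᵍ z * mᵍ z
Nm≡ℓ∞²+mᵍ² z with ℓ∞-mᵍ-cases z
... | inj₁ (ℓ≡ , m≡) = sym (cong₂ _+_ (cong₂ _*_ ℓ≡ ℓ≡) (cong₂ _*_ m≡ m≡))
... | inj₂ (ℓ≡ , m≡) = trans (+-comm (∣ re z ∣ * ∣ re z ∣) _)
                             (sym (cong₂ _+_ (cong₂ _*_ ℓ≡ ℓ≡) (cong₂ _*_ m≡ m≡)))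

mᵍ≤ℓ∞ : ∀ z → mᵍ z ≤ ℓ∞ z
mᵍ≤ℓ∞ (mk x y) = ≤-trans (m⊓n≤m ∣ x ∣ ∣ y ∣) (m≤m⊔n ∣ x ∣ ∣ y ∣)

ℓ∞≡0⇒≡0ᵍ : ∀ {z} → ℓ∞ z ≡ 0 → z ≡ 0ᵍ
ℓ∞≡0⇒≡0ᵍ {mk x y} ℓ≡0 = cong₂ mk (component (m≤m⊔n ∣ x ∣ ∣ y ∣)) (component (m≤n⊔m ∣ x ∣ ∣ y ∣))
  where
  component : ∀ {a} → ∣ a ∣ ≤ ∣ x ∣ ⊔ ∣ y ∣ → a ≡ + 0
  component a≤ℓ = ℤP.∣i∣≡0⇒i≡0 (n≤0⇒n≡0 (≤-trans a≤ℓ (≤-reflexive ℓ≡0)))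

≢0ᵍ⇒ℓ∞>0 : ∀ {z} → z ≢ 0ᵍ → 0 < ℓ∞ z
≢0ᵍ⇒ℓ∞>0 {z} z≢0 with ℓ∞ z in ℓ≡
... | zero  = ⊥-elim (z≢0 (ℓ∞≡0⇒≡0ᵍ ℓ≡))
... | suc _ = s≤s z≤n

-ᵍ1*ᵍ : ∀ z → (-ᵍ 1ᵍ) *ᵍ z ≡ -ᵍ z
-ᵍ1*ᵍ = solve-∀ 𝔾-ring

-ᵍi*ᵍ : ∀ z → (-ᵍ iᵍ) *ᵍ z ≡ -ᵍ (iᵍ *ᵍ z)
-ᵍi*ᵍ = solve-∀ 𝔾-ring

ℓ∞-neg : ∀ z → ℓ∞ (-ᵍ z) ≡ ℓ∞ z
ℓ∞-neg (mk x y) = cong₂ _⊔_ (ℤP.∣-i∣≡∣i∣ x) (ℤP.∣-i∣≡∣i∣ y)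

mᵍ-neg : ∀ z → mᵍ (-ᵍ z) ≡ mᵍ z
mᵍ-neg (mk x y) = cong₂ _⊓_ (ℤP.∣-i∣≡∣i∣ x) (ℤP.∣-i∣≡∣i∣ y)

ℓ∞-*i : ∀ z → ℓ∞ (iᵍ *ᵍ z) ≡ ℓ∞ z
ℓ∞-*i (mk x y) = trans (cong ℓ∞ (iᵍ*mk x y))
                       (trans (cong (_⊔ ∣ x ∣) (ℤP.∣-i∣≡∣i∣ y)) (⊔-comm ∣ y ∣ ∣ x ∣))

mᵍ-*i : ∀ z → mᵍ (iᵍ *ᵍ z) ≡ mᵍ z
mᵍ-*i (mk x y) = trans (cong mᵍ (iᵍ*mk x y))
                       (trans (cong (_⊓ ∣ x ∣) (ℤP.∣-i∣≡∣i∣ y)) (⊓-comm ∣ y ∣ ∣ x ∣))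

ℓ∞-*unit : ∀ {u} → IsUnit u → ∀ z → ℓ∞ (u *ᵍ z) ≡ ℓ∞ z
ℓ∞-*unit (inj₁ (inj₁ refl)) z = cong ℓ∞ (*ᵍ-identityˡ z)
ℓ∞-*unit (inj₁ (inj₂ refl)) z = trans (cong ℓ∞ (-ᵍ1*ᵍ z)) (ℓ∞-neg z)
ℓ∞-*unit (inj₂ (inj₁ refl)) z = ℓ∞-*i z
ℓ∞-*unit (inj₂ (inj₂ refl)) z = trans (cong ℓ∞ (-ᵍi*ᵍ z)) (trans (ℓ∞-neg (iᵍ *ᵍ z)) (ℓ∞-*i z))

mᵍ-*unit : ∀ {u} → IsUnit u → ∀ z → mᵍ (u *ᵍ z) ≡ mᵍ z
mᵍ-*unit (inj₁ (inj₁ refl)) z = cong mᵍ (*ᵍ-identityˡ z)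
mᵍ-*unit (inj₁ (inj₂ refl)) z = trans (cong mᵍ (-ᵍ1*ᵍ z)) (mᵍ-neg z)
mᵍ-*unit (inj₂ (inj₁ refl)) z = mᵍ-*i z
mᵍ-*unit (inj₂ (inj₂ refl)) z = trans (cong mᵍ (-ᵍi*ᵍ z)) (trans (mᵍ-neg (iᵍ *ᵍ z)) (mᵍ-*i z))

ℓ₁-*unit : ∀ {u} → IsUnit u → ∀ z → ℓ₁ (u *ᵍ z) ≡ ℓ₁ z
ℓ₁-*unit {u} unit z = begin
  ℓ₁ (u *ᵍ z)                  ≡⟨ ℓ∞+mᵍ≡ℓ₁ (u *ᵍ z) ⟨
  ℓ∞ (u *ᵍ z) + mᵍ (u *ᵍ z)    ≡⟨ cong₂ _+_ (ℓ∞-*unit unit z) (mᵍ-*unit unit z) ⟩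
  ℓ∞ z + mᵍ z                  ≡⟨ ℓ∞+mᵍ≡ℓ₁ z ⟩
  ℓ₁ z                         ∎
  where open ≡-Reasoning

ℓ∞-*ι : ∀ z k → ℓ∞ (z *ᵍ ι (+ k)) ≡ ℓ∞ z * k
ℓ∞-*ι (mk x y) k = begin
  ℓ∞ (mk x y *ᵍ ι (+ k))                    ≡⟨ cong ℓ∞ (mk*ι x y (+ k)) ⟩
  ∣ x ℤ.* + k ∣ ⊔ ∣ y ℤ.* + k ∣              ≡⟨ cong₂ _⊔_ (ℤP.abs-* x (+ k)) (ℤP.abs-* y (+ k)) ⟩
  (∣ x ∣ * k) ⊔ (∣ y ∣ * k)                  ≡⟨ *-distribʳ-⊔ k ∣ x ∣ ∣ y ∣ ⟨
  (∣ x ∣ ⊔ ∣ y ∣) * k                        ∎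
  where open ≡-Reasoning

mᵍ-*ι : ∀ z k → mᵍ (z *ᵍ ι (+ k)) ≡ mᵍ z * k
mᵍ-*ι (mk x y) k = begin
  mᵍ (mk x y *ᵍ ι (+ k))                    ≡⟨ cong mᵍ (mk*ι x y (+ k)) ⟩
  ∣ x ℤ.* + k ∣ ⊓ ∣ y ℤ.* + k ∣              ≡⟨ cong₂ _⊓_ (ℤP.abs-* x (+ k)) (ℤP.abs-* y (+ k)) ⟩
  (∣ x ∣ * k) ⊓ (∣ y ∣ * k)                  ≡⟨ *-distribʳ-⊓ k ∣ x ∣ ∣ y ∣ ⟨
  (∣ x ∣ ⊓ ∣ y ∣) * k                        ∎
  where open ≡-Reasoning

ℓ₁-*ι : ∀ z k → ℓ₁ (z *ᵍ ι (+ k)) ≡ ℓ₁ z * k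
ℓ₁-*ι (mk x y) k = begin
  ℓ₁ (mk x y *ᵍ ι (+ k))                    ≡⟨ cong ℓ₁ (mk*ι x y (+ k)) ⟩
  ∣ x ℤ.* + k ∣ + ∣ y ℤ.* + k ∣              ≡⟨ cong₂ _+_ (ℤP.abs-* x (+ k)) (ℤP.abs-* y (+ k)) ⟩
  ∣ x ∣ * k + ∣ y ∣ * k                      ≡⟨ *-distribʳ-+ k ∣ x ∣ ∣ y ∣ ⟨
  (∣ x ∣ + ∣ y ∣) * k                        ∎
  where open ≡-Reasoning

ℓ∞-triangle : ∀ x y → ℓ∞ (x +ᵍ y) ≤ ℓ∞ x + ℓ∞ y
ℓ∞-triangle (mk a b) (mk c d) = ⊔-lub
  (≤-trans (ℤP.∣i+j∣≤∣i∣+∣j∣ a c) (+-mono-≤ (m≤m⊔n ∣ a ∣ ∣ b ∣) (m≤m⊔n ∣ c ∣ ∣ d ∣)))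
  (≤-trans (ℤP.∣i+j∣≤∣i∣+∣j∣ b d) (+-mono-≤ (m≤n⊔m ∣ a ∣ ∣ b ∣) (m≤n⊔m ∣ c ∣ ∣ d ∣)))

ℓ₁-triangle : ∀ x y → ℓ₁ (x +ᵍ y) ≤ ℓ₁ x + ℓ₁ y
ℓ₁-triangle (mk a b) (mk c d) = begin
  ∣ a ℤ.+ c ∣ + ∣ b ℤ.+ d ∣              ≤⟨ +-mono-≤ (ℤP.∣i+j∣≤∣i∣+∣j∣ a c) (ℤP.∣i+j∣≤∣i∣+∣j∣ b d) ⟩
  (∣ a ∣ + ∣ c ∣) + (∣ b ∣ + ∣ d ∣)       ≡⟨ interchange (∣ a ∣) (∣ c ∣) (∣ b ∣) (∣ d ∣) ⟩
  (∣ a ∣ + ∣ b ∣) + (∣ c ∣ + ∣ d ∣)       ∎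
  where
  open ≤-Reasoning
  interchange : ∀ a c b d → (a + c) + (b + d) ≡ (a + b) + (c + d)
  interchange = ℕ-Solver.solve-∀

∣i∣+∣j∣≡∣i+j∣⊔∣i-j∣ : ∀ i j → ∣ i ∣ + ∣ j ∣ ≡ ∣ i ℤ.+ j ∣ ⊔ ∣ i ℤ.- j ∣
∣i∣+∣j∣≡∣i+j∣⊔∣i-j∣ i j = ≤-antisym (∣i∣+∣j∣≤ i j) (⊔-lub (ℤP.∣i+j∣≤∣i∣+∣j∣ i j) (ℤP.∣i-j∣≤∣i∣+∣j∣ i j))
  where
  ∣-[1+m]-n∣ : ∀ m n → ∣ -[1+ m ] ℤ.- + n ∣ ≡ suc m + n
  ∣-[1+m]-n∣ m zero    = sym (+-identityʳ (suc m))
  ∣-[1+m]-n∣ m (suc n) = cong suc (sym (+-suc m n))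
  ∣i∣+∣j∣≤ : ∀ i j → ∣ i ∣ + ∣ j ∣ ≤ ∣ i ℤ.+ j ∣ ⊔ ∣ i ℤ.- j ∣
  ∣i∣+∣j∣≤ (+ m)    (+ n)    = m≤m⊔n (m + n) _
  ∣i∣+∣j∣≤ (+ m)    -[1+ n ] = m≤n⊔m _ (m + suc n)
  ∣i∣+∣j∣≤ -[1+ m ] (+ n)    = ≤-trans (≤-reflexive (sym (∣-[1+m]-n∣ m n))) (m≤n⊔m _ _)
  ∣i∣+∣j∣≤ -[1+ m ] -[1+ n ] = ≤-trans (≤-reflexive (cong suc (+-suc m n))) (m≤m⊔n _ ∣ -[1+ m ] ℤ.- -[1+ n ] ∣)

ℓ∞-1+i* : ∀ z → ℓ∞ (1+i *ᵍ z) ≡ ℓ₁ z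
ℓ∞-1+i* (mk x y) = begin
  ℓ∞ (1+i *ᵍ mk x y)           ≡⟨ cong ℓ∞ (1+i*mk x y) ⟩
  ∣ x ℤ.- y ∣ ⊔ ∣ x ℤ.+ y ∣    ≡⟨ ⊔-comm ∣ x ℤ.- y ∣ ∣ x ℤ.+ y ∣ ⟩
  ∣ x ℤ.+ y ∣ ⊔ ∣ x ℤ.- y ∣    ≡⟨ ∣i∣+∣j∣≡∣i+j∣⊔∣i-j∣ x y ⟨
  ∣ x ∣ + ∣ y ∣                ∎
  where open ≡-Reasoning

ℓ₁-1+i* : ∀ z → ℓ₁ (1+i *ᵍ z) ≡ 2 * ℓ∞ z
ℓ₁-1+i* (mk x y) = begin
  ℓ₁ (1+i *ᵍ mk x y)                                    ≡⟨ cong ℓ₁ (1+i*mk x y) ⟩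
  ∣ x ℤ.- y ∣ + ∣ x ℤ.+ y ∣                             ≡⟨ ∣i∣+∣j∣≡∣i+j∣⊔∣i-j∣ (x ℤ.- y) (x ℤ.+ y) ⟩
  ∣ (x ℤ.- y) ℤ.+ (x ℤ.+ y) ∣ ⊔ ∣ (x ℤ.- y) ℤ.- (x ℤ.+ y) ∣
    ≡⟨ cong₂ _⊔_ (cong ∣_∣ (sum x y)) (trans (cong ∣_∣ (difference x y)) (ℤP.∣-i∣≡∣i∣ (+ 2 ℤ.* y))) ⟩
  ∣ + 2 ℤ.* x ∣ ⊔ ∣ + 2 ℤ.* y ∣                         ≡⟨ cong₂ _⊔_ (ℤP.abs-* (+ 2) x) (ℤP.abs-* (+ 2) y) ⟩
  (2 * ∣ x ∣) ⊔ (2 * ∣ y ∣)                             ≡⟨ *-distribˡ-⊔ 2 ∣ x ∣ ∣ y ∣ ⟨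
  2 * (∣ x ∣ ⊔ ∣ y ∣)                                   ∎
  where
  open ≡-Reasoning
  sum : ∀ x y → (x ℤ.- y) ℤ.+ (x ℤ.+ y) ≡ + 2 ℤ.* x
  sum = ℤ-Solver.solve-∀
  difference : ∀ x y → (x ℤ.- y) ℤ.- (x ℤ.+ y) ≡ ℤ.- (+ 2 ℤ.* y)
  difference = ℤ-Solver.solve-∀

∣ᵍ-*ˡ : ∀ {d z} u → d ∣ᵍ z → d ∣ᵍ (u *ᵍ z)
∣ᵍ-*ˡ {d} u (q , refl) = u *ᵍ q , sym (*ᵍ-assoc u q d)

ι∣ᵍ⇒ : ∀ {d z} → ι (+ d) ∣ᵍ z → (d ∣ ℓ∞ z) × (d ∣ mᵍ z)
ι∣ᵍ⇒ {d} (q , refl) = divides (ℓ∞ q) (ℓ∞-*ι q d) , divides (mᵍ q) (mᵍ-*ι q d)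

ι∣ᵍ-from-components : ∀ {d z} → d ∣ ∣ re z ∣ → d ∣ ∣ im z ∣ → ι (+ d) ∣ᵍ z
ι∣ᵍ-from-components {d} re∣ im∣ with ℤ∣.∣ᵤ⇒∣ re∣ | ℤ∣.∣ᵤ⇒∣ im∣
... | ℤ∣.divides q₁ eq₁ | ℤ∣.divides q₂ eq₂ =
  mk q₁ q₂ , trans (cong₂ mk eq₁ eq₂) (sym (mk*ι q₁ q₂ (+ d)))

ι∣ᵍ⇐ : ∀ {d z} → d ∣ ℓ∞ z → d ∣ mᵍ z → ι (+ d) ∣ᵍ z
ι∣ᵍ⇐ {d} {z} ℓ∣ m∣ with ℓ∞-mᵍ-cases z
... | inj₁ (ℓ≡ , m≡) = ι∣ᵍ-from-components (subst (d ∣_) ℓ≡ ℓ∣) (subst (d ∣_) m≡ m∣)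
... | inj₂ (ℓ≡ , m≡) = ι∣ᵍ-from-components (subst (d ∣_) m≡ m∣) (subst (d ∣_) ℓ≡ ℓ∣)

2∤ᵍ_ : 𝔾 → Set
2∤ᵍ z = ¬ (ι (+ 2) ∣ᵍ z)

ι2∣ᵍ? : ∀ z → Dec (ι (+ 2) ∣ᵍ z)
ι2∣ᵍ? z = map′ (uncurry ι∣ᵍ⇐) ι∣ᵍ⇒ ((2 ∣? ℓ∞ z) ×-dec (2 ∣? mᵍ z))

2∤ᵍ⇒≢0ᵍ : ∀ {z} → 2∤ᵍ z → z ≢ 0ᵍ
2∤ᵍ⇒≢0ᵍ odd refl = odd (0ᵍ , refl)

2∤ᵍ-*i : ∀ {z} → 2∤ᵍ z → 2∤ᵍ (iᵍ *ᵍ z)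
2∤ᵍ-*i {z} odd 2∣iz = odd (subst (ι (+ 2) ∣ᵍ_) (-i*i* z) (∣ᵍ-*ˡ (-ᵍ iᵍ) 2∣iz))
  where
  -i*i* : ∀ z → (-ᵍ iᵍ) *ᵍ (iᵍ *ᵍ z) ≡ z
  -i*i* = solve-∀ 𝔾-ring

2∤ᵍ-if-ℓ₁-odd : ∀ {z} → ¬ 2 ∣ ℓ₁ z → 2∤ᵍ z
2∤ᵍ-if-ℓ₁-odd {z} ℓ₁-odd 2∣z with ι∣ᵍ⇒ 2∣z
... | ℓ∣ , m∣ = ℓ₁-odd (subst (2 ∣_) (ℓ∞+mᵍ≡ℓ₁ z) (ℕ∣.∣m∣n⇒∣m+n ℓ∣ m∣))

*ι2^suc : ∀ g t → g *ᵍ ι (+ 2 ^ suc t) ≡ (g *ᵍ ι (+ 2 ^ t)) *ᵍ ι (+ 2)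
*ι2^suc g t = begin
  g *ᵍ ι (+ (2 * 2 ^ t))             ≡⟨ cong (λ k → g *ᵍ ι k) (ℤP.pos-* 2 (2 ^ t)) ⟩
  g *ᵍ ι (+ 2 ℤ.* + 2 ^ t)           ≡⟨ cong (g *ᵍ_) (ι-* (+ 2) (+ 2 ^ t)) ⟩
  g *ᵍ (ι (+ 2) *ᵍ ι (+ 2 ^ t))      ≡⟨ rearrange g (ι (+ 2)) (ι (+ 2 ^ t)) ⟩
  (g *ᵍ ι (+ 2 ^ t)) *ᵍ ι (+ 2)      ∎
  where
  open ≡-Reasoning
  rearrange : ∀ g a b → g *ᵍ (a *ᵍ b) ≡ (g *ᵍ b) *ᵍ a
  rearrange = solve-∀ 𝔾-ring

2-adic : ∀ {z} → z ≢ 0ᵍ → ∃ λ t → ∃ λ g → z ≡ g *ᵍ ι (+ 2 ^ t) × 2∤ᵍ g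
2-adic {z} z≢0 = <-rec Decomposable decompose (ℓ∞ z) z refl z≢0
  where
  Decomposable : ℕ → Set
  Decomposable n = ∀ z → ℓ∞ z ≡ n → z ≢ 0ᵍ → ∃ λ t → ∃ λ g → z ≡ g *ᵍ ι (+ 2 ^ t) × 2∤ᵍ g
  decompose : ∀ n → (∀ {m} → m < n → Decomposable m) → Decomposable n
  decompose n rec z ℓ≡n z≢0 with ι2∣ᵍ? z
  ... | no odd = 0 , z , sym (*ᵍ-identityʳ z) , odd
  ... | yes (q , refl) with rec ℓq<n q refl q≢0
    where
    q≢0 : q ≢ 0ᵍ
    q≢0 q≡0 = z≢0 (cong (_*ᵍ ι (+ 2)) q≡0)
    ℓq<n : ℓ∞ q < n
    ℓq<n = begin-strict
      ℓ∞ q      <⟨ m<m*n (ℓ∞ q) 2 {{ℕ.>-nonZero (≢0ᵍ⇒ℓ∞>0 q≢0)}} (s≤s (s≤s z≤n)) ⟩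
      ℓ∞ q * 2  ≡⟨ trans (sym (ℓ∞-*ι q 2)) ℓ≡n ⟩
      n         ∎
      where open ≤-Reasoning
  ... | t , g , refl , odd = suc t , g , sym (*ι2^suc g t) , odd

-- Expansions in base 1 + i

HasPaddedRep : 𝔾 → ℕ → Set
HasPaddedRep z m = Σ (Vec Digit (suc m)) λ ds → eval ds ≡ z

rotate : Digit → Digit
rotate d0  = d0
rotate d1  = di
rotate di  = d-1
rotate d-1 = d-i
rotate d-i = d1

digit-rotate : ∀ d → digit (rotate d) ≡ iᵍ *ᵍ digit d
digit-rotate d0  = refl
digit-rotate d1  = refl
digit-rotate di  = refl
digit-rotate d-1 = refl
digit-rotate d-i = refl

eval-rotate : ∀ {n} (ds : Vec Digit n) → eval (Vec.map rotate ds) ≡ iᵍ *ᵍ eval ds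
eval-rotate []       = refl
eval-rotate (d ∷ ds) = begin
  digit (rotate d) +ᵍ 1+i *ᵍ eval (Vec.map rotate ds)
    ≡⟨ cong₂ (λ u e → u +ᵍ 1+i *ᵍ e) (digit-rotate d) (eval-rotate ds) ⟩
  iᵍ *ᵍ digit d +ᵍ 1+i *ᵍ (iᵍ *ᵍ eval ds)
    ≡⟨ distrib (digit d) (eval ds) ⟩
  iᵍ *ᵍ (digit d +ᵍ 1+i *ᵍ eval ds) ∎
  where
  open ≡-Reasoning
  distrib : ∀ u e → iᵍ *ᵍ u +ᵍ 1+i *ᵍ (iᵍ *ᵍ e) ≡ iᵍ *ᵍ (u +ᵍ 1+i *ᵍ e)
  distrib = solve-∀ 𝔾-ring

HasPaddedRep-*i : ∀ {z m} → HasPaddedRep z m → HasPaddedRep (iᵍ *ᵍ z) m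
HasPaddedRep-*i (ds , refl) = Vec.map rotate ds , eval-rotate ds

HasPaddedRep-*i⁻¹ : ∀ {z m} → HasPaddedRep (iᵍ *ᵍ z) m → HasPaddedRep z m
HasPaddedRep-*i⁻¹ {z} {m} rep =
  subst (λ x → HasPaddedRep x m) (i⁴ z) (HasPaddedRep-*i (HasPaddedRep-*i (HasPaddedRep-*i rep)))
  where
  i⁴ : ∀ z → iᵍ *ᵍ (iᵍ *ᵍ (iᵍ *ᵍ (iᵍ *ᵍ z))) ≡ z
  i⁴ = solve-∀ 𝔾-ring

HasPaddedRep-cons : ∀ d {e m} → HasPaddedRep e m → HasPaddedRep (digit d +ᵍ 1+i *ᵍ e) (suc m)
HasPaddedRep-cons d (ds , refl) = d ∷ ds , refl

-- 2 = (1 + i)² · i³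
HasPaddedRep-*2 : ∀ {g m} → HasPaddedRep g m → HasPaddedRep (g *ᵍ ι (+ 2)) (suc (suc m))
HasPaddedRep-*2 {g} rep = subst (λ z → HasPaddedRep z _) (doubling g)
  (HasPaddedRep-cons d0 (HasPaddedRep-cons d0
    (HasPaddedRep-*i (HasPaddedRep-*i (HasPaddedRep-*i rep)))))
  where
  doubling : ∀ g → digit d0 +ᵍ 1+i *ᵍ (digit d0 +ᵍ 1+i *ᵍ (iᵍ *ᵍ (iᵍ *ᵍ (iᵍ *ᵍ g)))) ≡ g *ᵍ ι (+ 2)
  doubling = solve-∀ 𝔾-ring

*ι2-injective : ∀ {x y} → x *ᵍ ι (+ 2) ≡ y *ᵍ ι (+ 2) → x ≡ y
*ι2-injective {mk a b} {mk c d} eq with trans (sym (mk*ι a b (+ 2))) (trans eq (mk*ι c d (+ 2)))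
... | eq′ = cong₂ mk (ℤP.*-cancelʳ-≡ a c (+ 2) (cong re eq′)) (ℤP.*-cancelʳ-≡ b d (+ 2) (cong im eq′))

1+i-cancel : ∀ {x y} → 1+i *ᵍ x ≡ 1+i *ᵍ y → x ≡ y
1+i-cancel {x} {y} eq = *ι2-injective (begin
  x *ᵍ ι (+ 2)                   ≡⟨ conj-1+i* x ⟩
  conj 1+i *ᵍ (1+i *ᵍ x)         ≡⟨ cong (conj 1+i *ᵍ_) eq ⟩
  conj 1+i *ᵍ (1+i *ᵍ y)         ≡⟨ conj-1+i* y ⟨
  y *ᵍ ι (+ 2)                   ∎)
  where
  open ≡-Reasoning
  conj-1+i* : ∀ z → z *ᵍ ι (+ 2) ≡ conj 1+i *ᵍ (1+i *ᵍ z)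
  conj-1+i* = solve-∀ 𝔾-ring

re+im : 𝔾 → ℤ
re+im z = re z ℤ.+ im z

re+im-step : ∀ u e → re+im (u +ᵍ 1+i *ᵍ e) ≡ re+im u ℤ.+ + 2 ℤ.* re e
re+im-step (mk u₁ u₂) (mk e₁ e₂) = expand u₁ u₂ e₁ e₂
  where
  expand : ∀ u₁ u₂ e₁ e₂ → (u₁ ℤ.+ (+ 1 ℤ.* e₁ ℤ.- + 1 ℤ.* e₂)) ℤ.+ (u₂ ℤ.+ (+ 1 ℤ.* e₂ ℤ.+ + 1 ℤ.* e₁))
                         ≡ (u₁ ℤ.+ u₂) ℤ.+ + 2 ℤ.* e₁
  expand = ℤ-Solver.solve-∀

∣i∣≡1⇒i≢2* : ∀ {i} k → ∣ i ∣ ≡ 1 → i ≢ + 2 ℤ.* k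
∣i∣≡1⇒i≢2* {i} k ∣i∣≡1 i≡2k with ℕ∣.∣1⇒≡1 2∣1
  where
  2∣1 : 2 ∣ 1
  2∣1 = divides ∣ k ∣ (begin
    1               ≡⟨ ∣i∣≡1 ⟨
    ∣ i ∣           ≡⟨ cong ∣_∣ i≡2k ⟩
    ∣ + 2 ℤ.* k ∣   ≡⟨ ℤP.abs-* (+ 2) k ⟩
    2 * ∣ k ∣       ≡⟨ *-comm 2 ∣ k ∣ ⟩
    ∣ k ∣ * 2       ∎)
    where open ≡-Reasoning
... | ()

even-re+im⇒d0 : ∀ d k → re+im (digit d) ≡ + 2 ℤ.* k → d ≡ d0
even-re+im⇒d0 d0  k _    = refl
even-re+im⇒d0 d1  k even = ⊥-elim (∣i∣≡1⇒i≢2* k refl even)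
even-re+im⇒d0 di  k even = ⊥-elim (∣i∣≡1⇒i≢2* k refl even)
even-re+im⇒d0 d-1 k even = ⊥-elim (∣i∣≡1⇒i≢2* k refl even)
even-re+im⇒d0 d-i k even = ⊥-elim (∣i∣≡1⇒i≢2* k refl even)

-- re + im is even on multiples of 1 + i but ±1 on units.
cons≡1+i*⇒ : ∀ {d e f} → digit d +ᵍ 1+i *ᵍ e ≡ 1+i *ᵍ f → d ≡ d0 × e ≡ f
cons≡1+i*⇒ {d} {e} {f} eq with even-re+im⇒d0 d (re f ℤ.- re e) even
  where
  halve : ∀ a b c → a ℤ.+ + 2 ℤ.* b ≡ + 2 ℤ.* c → a ≡ + 2 ℤ.* (c ℤ.- b)
  halve a b c eq = trans (move a b) (trans (cong (ℤ._- + 2 ℤ.* b) eq) (factor c b))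
    where
    move : ∀ a b → a ≡ (a ℤ.+ + 2 ℤ.* b) ℤ.- + 2 ℤ.* b
    move = ℤ-Solver.solve-∀
    factor : ∀ c b → + 2 ℤ.* c ℤ.- + 2 ℤ.* b ≡ + 2 ℤ.* (c ℤ.- b)
    factor = ℤ-Solver.solve-∀
  even : re+im (digit d) ≡ + 2 ℤ.* (re f ℤ.- re e)
  even = halve (re+im (digit d)) (re e) (re f) (begin
    re+im (digit d) ℤ.+ + 2 ℤ.* re e   ≡⟨ re+im-step (digit d) e ⟨
    re+im (digit d +ᵍ 1+i *ᵍ e)        ≡⟨ cong re+im (trans eq (sym (+ᵍ-identityˡ (1+i *ᵍ f)))) ⟩
    re+im (0ᵍ +ᵍ 1+i *ᵍ f)             ≡⟨ re+im-step 0ᵍ f ⟩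
    + 0 ℤ.+ + 2 ℤ.* re f               ≡⟨ ℤP.+-identityˡ (+ 2 ℤ.* re f) ⟩
    + 2 ℤ.* re f                       ∎)
    where open ≡-Reasoning
... | refl = refl , 1+i-cancel (trans (sym (+ᵍ-identityˡ (1+i *ᵍ e))) eq)

HasPaddedRep-/1+i : ∀ {f m} → HasPaddedRep (1+i *ᵍ f) m → f ≢ 0ᵍ →
                    ∃ λ m′ → m ≡ suc m′ × HasPaddedRep f m′
HasPaddedRep-/1+i (d ∷ []      , eq) f≢0 = ⊥-elim (f≢0 (sym (proj₂ (cons≡1+i*⇒ {d} eq))))
HasPaddedRep-/1+i (d ∷ d′ ∷ ds , eq) f≢0 = _ , refl , (d′ ∷ ds , proj₂ (cons≡1+i*⇒ {d} eq))

≢0ᵍ-*unit : ∀ {u z} → IsUnit u → z ≢ 0ᵍ → u *ᵍ z ≢ 0ᵍ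
≢0ᵍ-*unit {u} {z} unit z≢0 uz≡0 = z≢0 (ℓ∞≡0⇒≡0ᵍ (trans (sym (ℓ∞-*unit unit z)) (cong ℓ∞ uz≡0)))

-- 2 = (1 + i)² · (- i)
HasPaddedRep-/2 : ∀ {g m} → HasPaddedRep (g *ᵍ ι (+ 2)) m → g ≢ 0ᵍ →
                  ∃ λ m′ → m ≡ suc (suc m′) × HasPaddedRep g m′
HasPaddedRep-/2 {g} {m} rep g≢0 =
  let (m₁ , m≡ , rep₁) = HasPaddedRep-/1+i (subst (λ z → HasPaddedRep z m) (halving g) rep) (-ig≢0 ∘ 1+i-cancel)
      (m₂ , m₁≡ , rep₂) = HasPaddedRep-/1+i rep₁ -ig≢0
  in m₂ , trans m≡ (cong suc m₁≡) , subst (λ z → HasPaddedRep z m₂) (i*-i* g) (HasPaddedRep-*i rep₂)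
  where
  halving : ∀ g → g *ᵍ ι (+ 2) ≡ 1+i *ᵍ (1+i *ᵍ ((-ᵍ iᵍ) *ᵍ g))
  halving = solve-∀ 𝔾-ring
  i*-i* : ∀ g → iᵍ *ᵍ ((-ᵍ iᵍ) *ᵍ g) ≡ g
  i*-i* = solve-∀ 𝔾-ring
  -ig≢0 : (-ᵍ iᵍ) *ᵍ g ≢ 0ᵍ
  -ig≢0 = ≢0ᵍ-*unit (inj₂ (inj₂ refl)) g≢0

-- Boxes

record WithinBox (m : ℕ) (z : 𝔾) : Set where
  constructor within
  field
    ℓ∞-bound : ℓ∞ z + 2 ≤ w m
    ℓ₁-bound : ℓ₁ z + 3 ≤ w (suc m)

3≤w : ∀ m → 3 ≤ w m
3≤w zero          = ≤-refl
3≤w (suc zero)    = s≤s (s≤s (s≤s z≤n))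
3≤w (suc (suc m)) = ≤-trans (s≤s (s≤s (s≤s z≤n))) (*-monoʳ-≤ 2 (3≤w m))

4≤w-suc : ∀ m → 4 ≤ w (suc m)
4≤w-suc zero    = ≤-refl
4≤w-suc (suc m) = ≤-trans (s≤s (s≤s (s≤s (s≤s z≤n)))) (*-monoʳ-≤ 2 (3≤w m))

w-suc-even : ∀ m → 2 ∣ w (suc m)
w-suc-even zero    = divides 2 refl
w-suc-even (suc m) = divides (w m) (*-comm 2 (w m))

w-<-suc : ∀ m → w m < w (suc m)
w-<-suc zero          = ≤-refl
w-<-suc (suc zero)    = s≤s (s≤s (s≤s (s≤s (s≤s z≤n))))
w-<-suc (suc (suc m)) = *-monoʳ-< 2 (w-<-suc m)

w-suc+2≤w-suc-suc : ∀ m → w (suc m) + 2 ≤ w (suc (suc m))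
w-suc+2≤w-suc-suc zero    = ≤-refl
w-suc+2≤w-suc-suc (suc m) = begin
  2 * w m + 2        ≡⟨ *-distribˡ-+ 2 (w m) 1 ⟨
  2 * (w m + 1)      ≤⟨ *-monoʳ-≤ 2 (≤-trans (≤-reflexive (+-comm (w m) 1)) (w-<-suc m)) ⟩
  2 * w (suc m)      ∎
  where open ≤-Reasoning

odd≤even⇒< : ∀ {a b} → ¬ 2 ∣ a → 2 ∣ b → a ≤ b → a < b
odd≤even⇒< 2∤a 2∣b a≤b = ≤∧≢⇒< a≤b (λ a≡b → 2∤a (subst (2 ∣_) (sym a≡b) 2∣b))

ℓ∞≤ℓ₁ : ∀ z → ℓ∞ z ≤ ℓ₁ z
ℓ∞≤ℓ₁ z = subst (ℓ∞ z ≤_) (ℓ∞+mᵍ≡ℓ₁ z) (m≤m+n (ℓ∞ z) (mᵍ z))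

ℓ₁-digit : ∀ d → ℓ₁ (digit d) ≤ 1
ℓ₁-digit d0  = z≤n
ℓ₁-digit d1  = ≤-refl
ℓ₁-digit di  = ≤-refl
ℓ₁-digit d-1 = ≤-refl
ℓ₁-digit d-i = ≤-refl

WithinBox-small : ∀ {z} m → ℓ₁ z ≤ 1 → WithinBox m z
WithinBox-small {z} m ℓ₁≤1 =
  within (≤-trans (+-monoˡ-≤ 2 (≤-trans (ℓ∞≤ℓ₁ z) ℓ₁≤1)) (3≤w m)) (≤-trans (+-monoˡ-≤ 3 ℓ₁≤1) (4≤w-suc m))

WithinBox-cons : ∀ d {e m} → WithinBox m e → WithinBox (suc m) (digit d +ᵍ 1+i *ᵍ e)
WithinBox-cons d {e} {m} (within ℓ∞-bound ℓ₁-bound) = within ℓ∞-cons ℓ₁-cons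
  where
  open ≤-Reasoning
  ℓ∞-cons : ℓ∞ (digit d +ᵍ 1+i *ᵍ e) + 2 ≤ w (suc m)
  ℓ∞-cons = begin
    ℓ∞ (digit d +ᵍ 1+i *ᵍ e) + 2         ≤⟨ +-monoˡ-≤ 2 (ℓ∞-triangle (digit d) (1+i *ᵍ e)) ⟩
    ℓ∞ (digit d) + ℓ∞ (1+i *ᵍ e) + 2     ≤⟨ +-monoˡ-≤ 2 (+-mono-≤ (≤-trans (ℓ∞≤ℓ₁ (digit d)) (ℓ₁-digit d))
                                                                   (≤-reflexive (ℓ∞-1+i* e))) ⟩
    1 + ℓ₁ e + 2                         ≡⟨ +-comm (1 + ℓ₁ e) 2 ⟩
    3 + ℓ₁ e                             ≡⟨ +-comm 3 (ℓ₁ e) ⟩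
    ℓ₁ e + 3                             ≤⟨ ℓ₁-bound ⟩
    w (suc m)                            ∎
  ℓ₁-cons : ℓ₁ (digit d +ᵍ 1+i *ᵍ e) + 3 ≤ w (suc (suc m))
  ℓ₁-cons = begin
    ℓ₁ (digit d +ᵍ 1+i *ᵍ e) + 3         ≤⟨ +-monoˡ-≤ 3 (ℓ₁-triangle (digit d) (1+i *ᵍ e)) ⟩
    ℓ₁ (digit d) + ℓ₁ (1+i *ᵍ e) + 3     ≤⟨ +-monoˡ-≤ 3 (+-mono-≤ (ℓ₁-digit d) (≤-reflexive (ℓ₁-1+i* e))) ⟩
    1 + 2 * ℓ∞ e + 3                     ≡⟨ regroup (ℓ∞ e) ⟩
    2 * (ℓ∞ e + 2)                       ≤⟨ *-monoʳ-≤ 2 ℓ∞-bound ⟩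
    2 * w m                              ∎
    where
    regroup : ∀ l → 1 + 2 * l + 3 ≡ 2 * (l + 2)
    regroup = ℕ-Solver.solve-∀

HasPaddedRep⇒WithinBox : ∀ {z m} → HasPaddedRep z m → z ≢ 0ᵍ → WithinBox m z
HasPaddedRep⇒WithinBox (ds , refl) = box ds
  where
  cons-zero : ∀ d {e} → e ≡ 0ᵍ → ℓ₁ (digit d +ᵍ 1+i *ᵍ e) ≤ 1
  cons-zero d refl = ≤-trans (≤-reflexive (cong ℓ₁ (+1+i*0 (digit d)))) (ℓ₁-digit d)
    where
    +1+i*0 : ∀ x → x +ᵍ 1+i *ᵍ 0ᵍ ≡ x
    +1+i*0 = solve-∀ 𝔾-ring
  box : ∀ {m} (ds : Vec Digit (suc m)) → eval ds ≢ 0ᵍ → WithinBox m (eval ds)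
  box {zero}  (d ∷ []) _ = WithinBox-small 0 (cons-zero d refl)
  box {suc m} (d ∷ ds) _ with eval ds ≟ᵍ 0ᵍ
  ... | yes e≡0 = WithinBox-small (suc m) (cons-zero d e≡0)
  ... | no  e≢0 = WithinBox-cons d (box ds e≢0)

≢0ᵍ-*ι2^ : ∀ {g} t → g ≢ 0ᵍ → g *ᵍ ι (+ 2 ^ t) ≢ 0ᵍ
≢0ᵍ-*ι2^ {g} t g≢0 g2^t≡0 = <-irrefl refl (begin-strict
  0                      <⟨ *-mono-≤ (≢0ᵍ⇒ℓ∞>0 g≢0) (m^n>0 2 t) ⟩
  ℓ∞ g * 2 ^ t           ≡⟨ ℓ∞-*ι g (2 ^ t) ⟨
  ℓ∞ (g *ᵍ ι (+ 2 ^ t))  ≡⟨ cong ℓ∞ g2^t≡0 ⟩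
  0                      ∎)
  where open ≤-Reasoning

HasPaddedRep-scaled⇒ : ∀ t {g m} → HasPaddedRep (g *ᵍ ι (+ 2 ^ t)) m → g ≢ 0ᵍ →
                       2 ^ t * (ℓ∞ g + 2) ≤ w m
HasPaddedRep-scaled⇒ zero {g} {m} rep g≢0 =
  subst (_≤ w m) (sym (*-identityˡ (ℓ∞ g + 2)))
    (WithinBox.ℓ∞-bound (HasPaddedRep⇒WithinBox (subst (λ z → HasPaddedRep z m) (*ᵍ-identityʳ g) rep) g≢0))
HasPaddedRep-scaled⇒ (suc t) {g} {m} rep g≢0 =
  let (m′ , m≡ , rep′) = HasPaddedRep-/2 (subst (λ z → HasPaddedRep z m) (*ι2^suc g t) rep) (≢0ᵍ-*ι2^ t g≢0)
  in subst (λ k → 2 ^ suc t * (ℓ∞ g + 2) ≤ w k) (sym m≡) (begin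
    2 * 2 ^ t * (ℓ∞ g + 2)     ≡⟨ *-assoc 2 (2 ^ t) (ℓ∞ g + 2) ⟩
    2 * (2 ^ t * (ℓ∞ g + 2))   ≤⟨ *-monoʳ-≤ 2 (HasPaddedRep-scaled⇒ t rep′ g≢0) ⟩
    2 * w m′                   ∎)
  where open ≤-Reasoning

quadrant-elim : (P : 𝔾 → Set) → (∀ {z} → P (iᵍ *ᵍ z) → P z) →
                (∀ X Y → P (mk (+ suc X) (+ Y))) → ∀ z → z ≢ 0ᵍ → P z
quadrant-elim P from-rotated first = elim
  where
  rotated : ∀ x y → P (mk (ℤ.- y) x) → P (mk x y)
  rotated x y p = from-rotated (subst P (sym (iᵍ*mk x y)) p)
  lower : ∀ x n → P (mk x -[1+ n ])
  lower (+ Y)    n = rotated (+ Y) -[1+ n ] (first n Y)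
  lower -[1+ m ] n = rotated _ _ (rotated _ _ (first m (suc n)))
  elim : ∀ z → z ≢ 0ᵍ → P z
  elim (mk (+ suc X)  (+ Y))     _   = first X Y
  elim (mk x          -[1+ n ])  _   = lower x n
  elim (mk (+ zero)   (+ zero))  z≢0 = ⊥-elim (z≢0 refl)
  elim (mk (+ zero)   (+ suc Y)) _   = rotated _ _ (rotated _ _ (lower (+ 0) Y))
  elim (mk -[1+ m ]   (+ Y))     _   = rotated _ _ (lower (ℤ.- (+ Y)) m)

parity : ∀ n → (∃ λ k → n ≡ k + k) ⊎ (∃ λ k → n ≡ k + k + 1)
parity zero = inj₁ (0 , refl)
parity (suc n) with parity n
... | inj₁ (k , refl) = inj₂ (k , +-comm 1 (k + k))
... | inj₂ (k , refl) = inj₁ (suc k , suc-odd k)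
  where
  suc-odd : ∀ k → suc (k + k + 1) ≡ suc k + suc k
  suc-odd = ℕ-Solver.solve-∀

2∣k+k : ∀ k → 2 ∣ k + k
2∣k+k k = divides k (double k)
  where
  double : ∀ k → k + k ≡ k * 2
  double = ℕ-Solver.solve-∀

2∤k+k+1 : ∀ k → ¬ 2 ∣ k + k + 1
2∤k+k+1 k 2∣odd with ℕ∣.∣1⇒≡1 (ℕ∣.∣m+n∣m⇒∣n 2∣odd (2∣k+k k))
... | ()

odd-pair : ℕ → ℕ → 𝔾
odd-pair p q = mk (+ (p + p + 1)) (+ (q + q + 1))

odd-pair/1+i : ℕ → ℕ → 𝔾
odd-pair/1+i p q = mk (+ (p + q + 1)) (+ q ℤ.- + p)

1+i*odd-pair/1+i : ∀ p q → 1+i *ᵍ odd-pair/1+i p q ≡ odd-pair p q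
1+i*odd-pair/1+i p q = trans (1+i*mk (+ (p + q + 1)) (+ q ℤ.- + p)) (cong₂ mk (re-pair (+ p) (+ q)) (im-pair (+ p) (+ q)))
  where
  re-pair : ∀ P Q → (P ℤ.+ Q ℤ.+ + 1) ℤ.- (Q ℤ.- P) ≡ P ℤ.+ P ℤ.+ + 1
  re-pair = ℤ-Solver.solve-∀
  im-pair : ∀ P Q → (P ℤ.+ Q ℤ.+ + 1) ℤ.+ (Q ℤ.- P) ≡ Q ℤ.+ Q ℤ.+ + 1
  im-pair = ℤ-Solver.solve-∀

2∤ℓ∞-odd-pair : ∀ p q → ¬ 2 ∣ ℓ∞ (odd-pair p q)
2∤ℓ∞-odd-pair p q with ⊔-sel (p + p + 1) (q + q + 1)
... | inj₁ ℓ≡ = subst (¬_ ∘ (2 ∣_)) (sym ℓ≡) (2∤k+k+1 p)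
... | inj₂ ℓ≡ = subst (¬_ ∘ (2 ∣_)) (sym ℓ≡) (2∤k+k+1 q)

WithinBox-/1+i : ∀ {e m} → ¬ 2 ∣ ℓ∞ (1+i *ᵍ e) → WithinBox (suc m) (1+i *ᵍ e) → WithinBox m e
WithinBox-/1+i {e} {m} ℓ∞-odd (within ℓ∞-bound ℓ₁-bound) = within ℓ∞-/1+i ℓ₁-/1+i
  where
  open ≤-Reasoning
  ℓ∞-/1+i : ℓ∞ e + 2 ≤ w m
  ℓ∞-/1+i = subst (_≤ w m) (sym (+-suc (ℓ∞ e) 1)) (*-cancelˡ-< 2 (ℓ∞ e + 1) (w m) (begin-strict
    2 * (ℓ∞ e + 1)           ≡⟨ *-distribˡ-+ 2 (ℓ∞ e) 1 ⟩
    2 * ℓ∞ e + 2             ≡⟨ cong (_+ 2) (ℓ₁-1+i* e) ⟨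
    ℓ₁ (1+i *ᵍ e) + 2        <⟨ +-monoʳ-< (ℓ₁ (1+i *ᵍ e)) ≤-refl ⟩
    ℓ₁ (1+i *ᵍ e) + 3        ≤⟨ ℓ₁-bound ⟩
    2 * w m                  ∎))
  ℓ₁-/1+i : ℓ₁ e + 3 ≤ w (suc m)
  ℓ₁-/1+i = subst (_≤ w (suc m)) (sym (+-suc (ℓ₁ e) 2)) (odd≤even⇒< odd (w-suc-even m)
    (subst (λ l → l + 2 ≤ w (suc m)) (ℓ∞-1+i* e) ℓ∞-bound))
    where
    odd : ¬ 2 ∣ ℓ₁ e + 2
    odd 2∣ = ℓ∞-odd (subst (2 ∣_) (sym (ℓ∞-1+i* e)) (ℕ∣.∣m+n∣m⇒∣n (subst (2 ∣_) (+-comm (ℓ₁ e) 2) 2∣) (divides 1 refl)))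

2∤ᵍ-/1+i : ∀ {e} → ¬ 2 ∣ ℓ∞ (1+i *ᵍ e) → 2∤ᵍ e
2∤ᵍ-/1+i {e} ℓ∞-odd = 2∤ᵍ-if-ℓ₁-odd (subst (¬_ ∘ (2 ∣_)) (ℓ∞-1+i* e) ℓ∞-odd)

WithinBox-*i : ∀ {z m} → WithinBox m z → WithinBox m (iᵍ *ᵍ z)
WithinBox-*i {z} {m} (within ℓ∞-bound ℓ₁-bound) = within
  (subst (λ l → l + 2 ≤ w m) (sym (ℓ∞-*i z)) ℓ∞-bound)
  (subst (λ l → l + 3 ≤ w (suc m)) (sym (ℓ₁-*unit (inj₂ (inj₁ refl)) z)) ℓ₁-bound)

WithinBox-mk-mono : ∀ {a b a′ b′ m} → a ≤ a′ → b ≤ b′ →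
                    WithinBox m (mk (+ a′) (+ b′)) → WithinBox m (mk (+ a) (+ b))
WithinBox-mk-mono a≤ b≤ (within ℓ∞-bound ℓ₁-bound) =
  within (≤-trans (+-monoˡ-≤ 2 (⊔-mono-≤ a≤ b≤)) ℓ∞-bound) (≤-trans (+-monoˡ-≤ 3 (+-mono-≤ a≤ b≤)) ℓ₁-bound)

WithinBox-+i : ∀ {a m} → 0 < a → WithinBox (suc m) (mk (+ a) (+ 0)) → WithinBox (suc m) (mk (+ a) (+ 1))
WithinBox-+i {a} {m} 0<a (within ℓ∞-bound _) = within
  (subst (λ l → l + 2 ≤ w (suc m)) (sym (m≥n⇒m⊔n≡m 0<a)) ℓ∞-bound′)
  (begin
    a + 1 + 3        ≡⟨ regroup a ⟩
    a + 2 + 2        ≤⟨ +-monoˡ-≤ 2 ℓ∞-bound′ ⟩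
    w (suc m) + 2    ≤⟨ w-suc+2≤w-suc-suc m ⟩
    w (suc (suc m))  ∎)
  where
  open ≤-Reasoning
  ℓ∞-bound′ : a + 2 ≤ w (suc m)
  ℓ∞-bound′ = subst (λ l → l + 2 ≤ w (suc m)) (⊔-identityʳ a) ℓ∞-bound
  regroup : ∀ a → a + 1 + 3 ≡ a + 2 + 2
  regroup = ℕ-Solver.solve-∀

suc+suc : ∀ k → suc k + suc k ≡ suc (k + k + 1)
suc+suc = ℕ-Solver.solve-∀

ℓ₁≤1-of-box₀ : ∀ {z} → WithinBox 0 z → ℓ₁ z ≤ 1
ℓ₁≤1-of-box₀ {z} box = +-cancelʳ-≤ 3 (ℓ₁ z) 1 (WithinBox.ℓ₁-bound box)

-- The digit d is chosen so that z − d has odd coordinates 2p + 1 and 2q + 1; the quotient of z − d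
-- by 1 + i is then again indivisible by 2 and lies in the previous box.
mutual
  HasPaddedRep-of-box : ∀ m {z} → 2∤ᵍ z → WithinBox m z → HasPaddedRep z m
  HasPaddedRep-of-box m {z} odd box =
    quadrant-elim (λ z → 2∤ᵍ z → WithinBox m z → HasPaddedRep z m)
      (λ rotated odd box → HasPaddedRep-*i⁻¹ (rotated (2∤ᵍ-*i odd) (WithinBox-*i box)))
      (first-quadrant m) z (2∤ᵍ⇒≢0ᵍ odd) odd box

  first-quadrant : ∀ m X Y → 2∤ᵍ (mk (+ suc X) (+ Y)) → WithinBox m (mk (+ suc X) (+ Y)) →
                   HasPaddedRep (mk (+ suc X) (+ Y)) m
  first-quadrant zero zero    zero    _ _   = d1 ∷ [] , refl
  first-quadrant zero (suc X) Y       _ box with ℓ₁≤1-of-box₀ box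
  ... | s≤s ()
  first-quadrant zero zero    (suc Y) _ box with ℓ₁≤1-of-box₀ box
  ... | s≤s ()
  first-quadrant (suc m) X Y odd box with parity (suc X) | parity Y
  ... | inj₁ (k , sX≡) | inj₁ (l , Y≡) =
    ⊥-elim (odd (ι∣ᵍ-from-components (subst (2 ∣_) (sym sX≡) (2∣k+k k)) (subst (2 ∣_) (sym Y≡) (2∣k+k l))))
  ... | inj₂ (p , sX≡) | inj₂ (q , Y≡) =
    step d0 p q (cong₂ mk (cong +_ sX≡) (cong +_ Y≡))
      (subst (WithinBox (suc m)) (cong₂ mk (cong +_ sX≡) (cong +_ Y≡)) box)
  ... | inj₁ (zero , ()) | inj₂ _
  ... | inj₁ (suc p , sX≡) | inj₂ (q , Y≡) =
    step d1 p q (cong₂ mk (cong +_ (trans sX≡ (suc+suc p))) (cong +_ Y≡))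
      (WithinBox-mk-mono (≤-trans (n≤1+n _) (≤-reflexive (sym (trans sX≡ (suc+suc p))))) (≤-reflexive (sym Y≡)) box)
  ... | inj₂ (p , sX≡) | inj₁ (zero , Y≡) =
    step d-i p 0 (cong₂ mk (cong +_ sX≡) (cong +_ Y≡))
      (WithinBox-+i (m≤n+m 1 (p + p)) (subst (WithinBox (suc m)) (cong₂ mk (cong +_ sX≡) (cong +_ Y≡)) box))
  ... | inj₂ (p , sX≡) | inj₁ (suc q , Y≡) =
    step di p q (cong₂ mk (cong +_ sX≡) (cong +_ (trans Y≡ (suc+suc q))))
      (WithinBox-mk-mono (≤-reflexive (sym sX≡)) (≤-trans (n≤1+n _) (≤-reflexive (sym (trans Y≡ (suc+suc q))))) box)

  step : ∀ {m z} d p q → z ≡ digit d +ᵍ odd-pair p q → WithinBox (suc m) (odd-pair p q) →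
         HasPaddedRep z (suc m)
  step {m} {z} d p q z≡ box = subst (λ x → HasPaddedRep x (suc m)) (sym z≡′)
    (HasPaddedRep-cons d (HasPaddedRep-of-box m (2∤ᵍ-/1+i {odd-pair/1+i p q} odd) (WithinBox-/1+i odd box′)))
    where
    z≡′ : z ≡ digit d +ᵍ 1+i *ᵍ odd-pair/1+i p q
    z≡′ = trans z≡ (cong (digit d +ᵍ_) (sym (1+i*odd-pair/1+i p q)))
    odd : ¬ 2 ∣ ℓ∞ (1+i *ᵍ odd-pair/1+i p q)
    odd = subst (¬_ ∘ (2 ∣_)) (cong ℓ∞ (sym (1+i*odd-pair/1+i p q))) (2∤ℓ∞-odd-pair p q)
    box′ : WithinBox (suc m) (1+i *ᵍ odd-pair/1+i p q)
    box′ = subst (WithinBox (suc m)) (sym (1+i*odd-pair/1+i p q)) box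

4<2^suc*[ℓ∞+2] : ∀ t {g} → 2∤ᵍ g → 4 < 2 ^ suc t * (ℓ∞ g + 2)
4<2^suc*[ℓ∞+2] t odd =
  ≤-trans (n≤1+n 5) (*-mono-≤ (*-monoʳ-≤ 2 (m^n>0 2 t)) (+-monoˡ-≤ 2 (≢0ᵍ⇒ℓ∞>0 (2∤ᵍ⇒≢0ᵍ odd))))

HasPaddedRep-of-scaled-box : ∀ t {g m} → 2∤ᵍ g → 2 ^ t * (ℓ∞ g + 2) ≤ w m → 2 ^ t * (ℓ₁ g + 3) ≤ w (suc m) →
                             HasPaddedRep (g *ᵍ ι (+ 2 ^ t)) m
HasPaddedRep-of-scaled-box zero {g} {m} odd ℓ∞-bound ℓ₁-bound =
  subst (λ z → HasPaddedRep z m) (sym (*ᵍ-identityʳ g)) (HasPaddedRep-of-box m odd (within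
    (subst (_≤ w m) (*-identityˡ (ℓ∞ g + 2)) ℓ∞-bound)
    (subst (_≤ w (suc m)) (*-identityˡ (ℓ₁ g + 3)) ℓ₁-bound)))
HasPaddedRep-of-scaled-box (suc t) {g} {zero} odd ℓ∞-bound _ =
  ⊥-elim (<⇒≱ (4<2^suc*[ℓ∞+2] t odd) (≤-trans ℓ∞-bound (n≤1+n 3)))
HasPaddedRep-of-scaled-box (suc t) {g} {suc zero} odd ℓ∞-bound _ =
  ⊥-elim (<⇒≱ (4<2^suc*[ℓ∞+2] t odd) ℓ∞-bound)
HasPaddedRep-of-scaled-box (suc t) {g} {suc (suc m)} odd ℓ∞-bound ℓ₁-bound =
  subst (λ z → HasPaddedRep z (suc (suc m))) (sym (*ι2^suc g t))
    (HasPaddedRep-*2 (HasPaddedRep-of-scaled-box t odd (halve ℓ∞-bound) (halve ℓ₁-bound)))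
  where
  halve : ∀ {x v} → 2 ^ suc t * x ≤ 2 * v → 2 ^ t * x ≤ v
  halve {x} {v} le = *-cancelˡ-≤ 2 (subst (_≤ 2 * v) (*-assoc 2 (2 ^ t) x) le)

2^∣2^ : ∀ {a b} → a ≤ b → 2 ^ a ∣ 2 ^ b
2^∣2^ {b = b} z≤n     = ℕ∣.1∣ (2 ^ b)
2^∣2^ (s≤s a≤b)       = ℕ∣.*-monoʳ-∣ 2 (2^∣2^ a≤b)

∣∣<⇒+≤ : ∀ {d u v} → d ∣ u → d ∣ v → u < v → u + d ≤ v
∣∣<⇒+≤ {d} {u} {v} d∣u d∣v u<v = begin
  u + d         ≤⟨ +-monoʳ-≤ u (ℕ∣.∣⇒≤ {{ℕ.>-nonZero (m<n⇒0<n∸m u<v)}} d∣v∸u) ⟩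
  u + (v ∸ u)   ≡⟨ m+[n∸m]≡n (<⇒≤ u<v) ⟩
  v             ∎
  where
  open ≤-Reasoning
  d∣v∸u : d ∣ v ∸ u
  d∣v∸u = ℕ∣.∣m+n∣m⇒∣n (subst (d ∣_) (sym (m+[n∸m]≡n (<⇒≤ u<v))) d∣v) d∣u

+3*2^t≤+2^suc : ∀ {s X t j} → 2 ^ t ∣ s → 2 ^ j ∣ X → t ≤ j → s < X → s + 3 * 2 ^ t ≤ X + 2 ^ suc j
+3*2^t≤+2^suc {s} {X} {t} {j} 2^t∣s 2^j∣X t≤j s<X with t ≟ j
... | yes refl = begin
  s + 3 * 2 ^ t             ≡⟨ regroup s (2 ^ t) ⟩
  s + 2 ^ t + 2 * 2 ^ t     ≤⟨ +-monoˡ-≤ (2 * 2 ^ t) (∣∣<⇒+≤ 2^t∣s 2^j∣X s<X) ⟩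
  X + 2 * 2 ^ t             ∎
  where
  open ≤-Reasoning
  regroup : ∀ s p → s + 3 * p ≡ s + p + 2 * p
  regroup = ℕ-Solver.solve-∀
... | no t≢j = begin
  s + 3 * 2 ^ t             ≤⟨ +-monoʳ-≤ s (*-monoˡ-≤ (2 ^ t) (n≤1+n 3)) ⟩
  s + 4 * 2 ^ t             ≡⟨ cong (λ x → s + x) (quadruple (2 ^ t)) ⟩
  s + 2 ^ suc (suc t)       ≤⟨ +-mono-≤ (<⇒≤ s<X) (^-monoʳ-≤ 2 (s≤s (≤∧≢⇒< t≤j t≢j))) ⟩
  X + 2 ^ suc j             ∎
  where
  open ≤-Reasoning
  quadruple : ∀ p → 4 * p ≡ 2 * (2 * p)
  quadruple = ℕ-Solver.solve-∀

HasPaddedRep-if-small : ∀ {z g t j m X} → z ≡ g *ᵍ ι (+ 2 ^ t) → 2∤ᵍ g → t ≤ j → 2 ^ j ∣ X → ℓ₁ z < X →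
                        X + 2 ^ suc j ≤ w (suc m) → ℓ∞ z + 2 ^ suc j ≤ w m → HasPaddedRep z m
HasPaddedRep-if-small {z} {g} {t} {j} {m} {X} refl odd t≤j 2^j∣X ℓ₁<X X-bound ℓ∞-bound =
  HasPaddedRep-of-scaled-box t odd ℓ∞-scaled ℓ₁-scaled
  where
  open ≤-Reasoning
  expand : ∀ p l k → p * (l + k) ≡ l * p + k * p
  expand = ℕ-Solver.solve-∀
  ℓ∞-scaled : 2 ^ t * (ℓ∞ g + 2) ≤ w m
  ℓ∞-scaled = begin
    2 ^ t * (ℓ∞ g + 2)          ≡⟨ expand (2 ^ t) (ℓ∞ g) 2 ⟩
    ℓ∞ g * 2 ^ t + 2 * 2 ^ t    ≡⟨ cong (λ x → x + 2 ^ suc t) (ℓ∞-*ι g (2 ^ t)) ⟨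
    ℓ∞ z + 2 ^ suc t            ≤⟨ +-monoʳ-≤ (ℓ∞ z) (^-monoʳ-≤ 2 (s≤s t≤j)) ⟩
    ℓ∞ z + 2 ^ suc j            ≤⟨ ℓ∞-bound ⟩
    w m                         ∎
  ℓ₁-scaled : 2 ^ t * (ℓ₁ g + 3) ≤ w (suc m)
  ℓ₁-scaled = begin
    2 ^ t * (ℓ₁ g + 3)          ≡⟨ expand (2 ^ t) (ℓ₁ g) 3 ⟩
    ℓ₁ g * 2 ^ t + 3 * 2 ^ t    ≡⟨ cong (λ x → x + 3 * 2 ^ t) (ℓ₁-*ι g (2 ^ t)) ⟨
    ℓ₁ z + 3 * 2 ^ t            ≤⟨ +3*2^t≤+2^suc (divides (ℓ₁ g) (ℓ₁-*ι g (2 ^ t))) 2^j∣X t≤j ℓ₁<X ⟩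
    X + 2 ^ suc j               ≤⟨ X-bound ⟩
    w (suc m)                   ∎

HasRep⇒HasPaddedRep : ∀ {z n} → HasRep z n → HasPaddedRep z n
HasRep⇒HasPaddedRep (ds , _ , eq) = ds , eq

ℓ∞+2^suc≤w : ∀ {b n j} → HasPaddedRep b n → b ≢ 0ᵍ → ι (+ 2 ^ j) ∣ᵍ b → ℓ∞ b + 2 ^ suc j ≤ w n
ℓ∞+2^suc≤w {n = n} {j} rep b≢0 (q , refl) = begin
  ℓ∞ (q *ᵍ ι (+ 2 ^ j)) + 2 ^ suc j   ≡⟨ cong (λ x → x + 2 ^ suc j) (ℓ∞-*ι q (2 ^ j)) ⟩
  ℓ∞ q * 2 ^ j + 2 * 2 ^ j            ≡⟨ factor (2 ^ j) (ℓ∞ q) ⟩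
  2 ^ j * (ℓ∞ q + 2)                  ≤⟨ HasPaddedRep-scaled⇒ j rep q≢0 ⟩
  w n                                 ∎
  where
  open ≤-Reasoning
  factor : ∀ p l → l * p + 2 * p ≡ p * (l + 2)
  factor = ℕ-Solver.solve-∀
  q≢0 : q ≢ 0ᵍ
  q≢0 q≡0 = b≢0 (cong (_*ᵍ ι (+ 2 ^ j)) q≡0)

last-∷ : ∀ {n} d (ds : Vec Digit (suc n)) → last (d ∷ ds) ≡ last ds
last-∷ d (_ ∷ _) = refl

trim : ∀ {z m} → HasPaddedRep z m → z ≢ 0ᵍ → ∃ λ k → k ≤ m × HasRep z k
trim (ds , refl) = go ds
  where
  cons : Digit → 𝔾 → 𝔾
  cons d e = digit d +ᵍ 1+i *ᵍ e
  top≢d0 : ∀ d {e} → cons d e ≢ 0ᵍ → e ≡ 0ᵍ → d ≢ d0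
  top≢d0 d z≢0 refl refl = z≢0 refl
  go : ∀ {m} (ds : Vec Digit (suc m)) → eval ds ≢ 0ᵍ → ∃ λ k → k ≤ m × HasRep (eval ds) k
  go {zero} (d ∷ []) z≢0 = 0 , z≤n , (d ∷ [] , top≢d0 d z≢0 refl , refl)
  go {suc m} (d ∷ ds) z≢0 with eval ds ≟ᵍ 0ᵍ
  ... | yes e≡0 = 0 , z≤n , (d ∷ [] , top≢d0 d z≢0 e≡0 , cong (cons d) (sym e≡0))
  ... | no  e≢0 = let (k , k≤m , es , top , eq) = go ds e≢0 in
    suc k , s≤s k≤m , (d ∷ es , top ∘ trans (sym (last-∷ d es)) , cong (cons d) eq)

_≟d0 : ∀ d → Dec (d ≡ d0)
d0  ≟d0 = yes refl
d1  ≟d0 = no (λ ())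
di  ≟d0 = no (λ ())
d-1 ≟d0 = no (λ ())
d-i ≟d0 = no (λ ())

∃Digit? : ∀ {P : Digit → Set} → (∀ d → Dec (P d)) → Dec (∃ P)
∃Digit? {P} P? = map′ to from (P? d0 ⊎-dec P? d1 ⊎-dec P? di ⊎-dec P? d-1 ⊎-dec P? d-i)
  where
  to : P d0 ⊎ P d1 ⊎ P di ⊎ P d-1 ⊎ P d-i → ∃ P
  to (inj₁ p)                         = d0 , p
  to (inj₂ (inj₁ p))                  = d1 , p
  to (inj₂ (inj₂ (inj₁ p)))           = di , p
  to (inj₂ (inj₂ (inj₂ (inj₁ p))))    = d-1 , p
  to (inj₂ (inj₂ (inj₂ (inj₂ p))))    = d-i , p
  from : ∃ P → P d0 ⊎ P d1 ⊎ P di ⊎ P d-1 ⊎ P d-i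
  from (d0  , p) = inj₁ p
  from (d1  , p) = inj₂ (inj₁ p)
  from (di  , p) = inj₂ (inj₂ (inj₁ p))
  from (d-1 , p) = inj₂ (inj₂ (inj₂ (inj₁ p)))
  from (d-i , p) = inj₂ (inj₂ (inj₂ (inj₂ p)))

∃Vec? : ∀ n {P : Vec Digit n → Set} → (∀ ds → Dec (P ds)) → Dec (∃ P)
∃Vec? zero    {P} P? = map′ ([] ,_) from (P? [])
  where
  from : ∃ P → P []
  from ([] , p) = p
∃Vec? (suc n) {P} P? = map′ to from (∃Digit? (λ d → ∃Vec? n (λ ds → P? (d ∷ ds))))
  where
  to : (∃ λ d → ∃ λ ds → P (d ∷ ds)) → ∃ P
  to (d , ds , p) = d ∷ ds , p
  from : ∃ P → ∃ λ d → ∃ λ ds → P (d ∷ ds)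
  from (d ∷ ds , p) = d , ds , p

HasRep? : ∀ z k → Dec (HasRep z k)
HasRep? z k = ∃Vec? (suc k) (λ ds → ¬? (last ds ≟d0) ×-dec (eval ds ≟ᵍ z))

Phi-of-HasRep : ∀ {z k} → HasRep z k → ∃ λ k′ → k′ ≤ k × Phi z k′
Phi-of-HasRep {z} {k} = <-rec Least least k
  where
  Least : ℕ → Set
  Least k = HasRep z k → ∃ λ k′ → k′ ≤ k × Phi z k′
  least : ∀ k → (∀ {j} → j < k → Least j) → Least k
  least k shorter rep with anyUpTo? (HasRep? z) k
  ... | yes (j , j<k , repⱼ) = let (k′ , k′≤j , φ) = shorter j<k repⱼ in k′ , ≤-trans k′≤j (<⇒≤ j<k) , φ
  ... | no  none             = k , ≤-refl , rep , λ j j<k repⱼ → none (j , j<k , repⱼ)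

Phi-of-HasPaddedRep : ∀ {z m} → HasPaddedRep z m → z ≢ 0ᵍ → ∃ λ k → k ≤ m × Phi z k
Phi-of-HasPaddedRep rep z≢0 =
  let (k , k≤m , repₖ) = trim rep z≢0
      (k′ , k′≤k , φ) = Phi-of-HasRep repₖ
  in k′ , ≤-trans k′≤k k≤m , φ

Phi≤ : ∀ {z k m} → Phi z k → HasPaddedRep z m → z ≢ 0ᵍ → k ≤ m
Phi≤ (_ , minimal) rep z≢0 =
  let (j , j≤m , repⱼ) = trim rep z≢0 in ≤-trans (≮⇒≥ (λ j<k → minimal j j<k repⱼ)) j≤m

-- The Gauss remainder

∣+m-+n∣≡n∸m : ∀ {m n} → m ≤ n → ∣ + m ℤ.- + n ∣ ≡ n ∸ m
∣+m-+n∣≡n∸m {m} {n} m≤n = trans (cong ∣_∣ (ℤP.[+m]-[+n]≡m⊖n m n)) (ℤP.∣⊖∣-≤ m≤n)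

∣+n-+m∣≡n∸m : ∀ {m n} → m ≤ n → ∣ + n ℤ.- + m ∣ ≡ n ∸ m
∣+n-+m∣≡n∸m {m} {n} m≤n = trans (ℤP.∣i-j∣≡∣j-i∣ (+ n) (+ m)) (∣+m-+n∣≡n∸m m≤n)

round-down-error : ∀ {p q r M} → p ≡ + r ℤ.+ q ℤ.* + M → 2 * r ≤ M → 2 * ∣ p ℤ.- q ℤ.* + M ∣ ≤ M
round-down-error {q = q} {r} {M} refl 2r≤M =
  subst (λ x → 2 * ∣ x ∣ ≤ M) (sym (cancel (+ r) (q ℤ.* + M))) 2r≤M
  where
  cancel : ∀ r t → (r ℤ.+ t) ℤ.- t ≡ r
  cancel = ℤ-Solver.solve-∀

round-up-error : ∀ {p q r M} → p ≡ + r ℤ.+ q ℤ.* + M → r ≤ M → M ≤ r + r →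
                 2 * ∣ p ℤ.- (q ℤ.+ + 1) ℤ.* + M ∣ ≤ M
round-up-error {q = q} {r} {M} refl r≤M M≤2r = begin
  2 * ∣ (+ r ℤ.+ q ℤ.* + M) ℤ.- (q ℤ.+ + 1) ℤ.* + M ∣  ≡⟨ cong (λ x → 2 * ∣ x ∣) (round-up (+ r) q (+ M)) ⟩
  2 * ∣ + r ℤ.- + M ∣                                  ≡⟨ cong (2 *_) (∣+m-+n∣≡n∸m r≤M) ⟩
  2 * (M ∸ r)                                          ≡⟨ cong (λ x → (M ∸ r) + x) (+-identityʳ (M ∸ r)) ⟩
  (M ∸ r) + (M ∸ r)                                    ≤⟨ +-monoʳ-≤ (M ∸ r) (m≤n+o⇒m∸n≤o M r M≤2r) ⟩
  (M ∸ r) + r                                          ≡⟨ m∸n+n≡m r≤M ⟩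
  M                                                    ∎
  where
  open ≤-Reasoning
  round-up : ∀ r q M → (r ℤ.+ q ℤ.* M) ℤ.- (q ℤ.+ + 1) ℤ.* M ≡ r ℤ.- M
  round-up = ℤ-Solver.solve-∀

roundDiv-error : ∀ p {N} → 0 < N → 2 * ∣ p ℤ.- roundDiv p N ℤ.* + N ∣ ≤ N
roundDiv-error p {suc n} _ with 2 * (p ℤ.%ℕ suc n) ℕ.≤ᵇ suc n in rounding
... | true  = round-down-error {q = p ℤ./ℕ suc n} (DM.a≡a%ℕn+[a/ℕn]*n p (suc n)) (≤ᵇ⇒≤ _ _ (subst T (sym rounding) tt))
... | false = round-up-error {q = p ℤ./ℕ suc n} (DM.a≡a%ℕn+[a/ℕn]*n p (suc n)) (<⇒≤ (DM.n%ℕd<d p (suc n)))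
  (≤-trans (<⇒≤ (≰⇒> (λ 2r≤M → subst T rounding (≤⇒≤ᵇ 2r≤M)))) (≤-reflexive (cong (λ x → r + x) (+-identityʳ r))))
  where
  r : ℕ
  r = p ℤ.%ℕ suc n

Nm>0 : ∀ {z} → z ≢ 0ᵍ → 0 < Nm z
Nm>0 {z} z≢0 = ≤-trans (*-mono-≤ ℓ>0 ℓ>0) (≤-trans (m≤m+n _ _) (≤-reflexive (sym (Nm≡ℓ∞²+mᵍ² z))))
  where
  ℓ>0 : 0 < ℓ∞ z
  ℓ>0 = ≢0ᵍ⇒ℓ∞>0 z≢0

gaussRem*conj≡ : ∀ a b → let c = a *ᵍ conj b in
  gaussRem a b *ᵍ conj b ≡ mk (re c ℤ.- roundDiv (re c) (Nm b) ℤ.* + Nm b)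
                              (im c ℤ.- roundDiv (im c) (Nm b) ℤ.* + Nm b)
gaussRem*conj≡ a b = begin
  (a -ᵍ q *ᵍ b) *ᵍ conj b           ≡⟨ distrib a q b (conj b) ⟩
  c -ᵍ q *ᵍ (b *ᵍ conj b)           ≡⟨ cong (λ n → c -ᵍ q *ᵍ n) (*conj≡ιNm b) ⟩
  c -ᵍ q *ᵍ ι (+ Nm b)              ≡⟨ cong (λ x → c -ᵍ x) (mk*ι (re q) (im q) (+ Nm b)) ⟩
  c -ᵍ mk (re q ℤ.* + Nm b) (im q ℤ.* + Nm b) ∎
  where
  open ≡-Reasoning
  c : 𝔾
  c = a *ᵍ conj b
  q : 𝔾
  q = gaussQuot a b
  distrib : ∀ a q b b′ → (a -ᵍ q *ᵍ b) *ᵍ b′ ≡ a *ᵍ b′ -ᵍ q *ᵍ (b *ᵍ b′)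
  distrib = solve-∀ 𝔾-ring

gaussRem-bound : ∀ a b → b ≢ 0ᵍ → 2 * ℓ∞ (gaussRem a b *ᵍ conj b) ≤ Nm b
gaussRem-bound a b b≢0 = begin
  2 * ℓ∞ (gaussRem a b *ᵍ conj b)           ≡⟨ cong (λ z → 2 * ℓ∞ z) (gaussRem*conj≡ a b) ⟩
  2 * (∣ re-error ∣ ⊔ ∣ im-error ∣)          ≡⟨ *-distribˡ-⊔ 2 ∣ re-error ∣ ∣ im-error ∣ ⟩
  (2 * ∣ re-error ∣) ⊔ (2 * ∣ im-error ∣)    ≤⟨ ⊔-lub (roundDiv-error (re c) (Nm>0 b≢0)) (roundDiv-error (im c) (Nm>0 b≢0)) ⟩
  Nm b                                      ∎
  where
  open ≤-Reasoning
  c : 𝔾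
  c = a *ᵍ conj b
  re-error : ℤ
  re-error = re c ℤ.- roundDiv (re c) (Nm b) ℤ.* + Nm b
  im-error : ℤ
  im-error = im c ℤ.- roundDiv (im c) (Nm b) ℤ.* + Nm b

-- With X = μ + k, the inequality and X ≤ P + c give 2ck ≤ k², while P < μ + c gives k < 2c;
-- so k = 0, and then the inequality gives P + c ≤ μ < P.
ℓ∞-gap : ∀ {X μ P c} → 0 < μ → μ ≤ X → μ < P → P < μ + c →
         2 * (P * μ + c * X) ≤ X * X + μ * μ → P + c < X
ℓ∞-gap {X} {μ} {P} {c} 0<μ μ≤X μ<P P<μ+c gauss with X ≤? P + c
... | no  X≰P+c = ≰⇒> X≰P+c
... | yes X≤P+c = ⊥-elim (gap (X ∸ μ) (m+[n∸m]≡n μ≤X))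
  where
  open ≤-Reasoning
  split-lhs : ∀ P c μ k → 2 * (P * μ + c * (μ + k)) ≡ 2 * (μ * (P + c)) + 2 * (c * k)
  split-lhs = ℕ-Solver.solve-∀
  split-rhs : ∀ μ k → (μ + k) * (μ + k) + μ * μ ≡ 2 * (μ * (μ + k)) + k * k
  split-rhs = ℕ-Solver.solve-∀
  split-lhs-0 : ∀ P c μ → 2 * (μ * (P + c)) ≡ 2 * (P * μ + c * (μ + 0))
  split-lhs-0 = ℕ-Solver.solve-∀
  split-rhs-0 : ∀ μ → 2 * (μ * (μ + 0)) + 0 ≡ 2 * (μ * μ)
  split-rhs-0 = ℕ-Solver.solve-∀
  twice-comm : ∀ k c → k * (2 * c) ≡ 2 * (c * k)
  twice-comm = ℕ-Solver.solve-∀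
  +twice : ∀ μ c → μ + c + c ≡ μ + 2 * c
  +twice = ℕ-Solver.solve-∀
  gap : ∀ k → μ + k ≡ X → ⊥
  gap k refl = k-cases k refl
    where
    2ck≤k² : 2 * (c * k) ≤ k * k
    2ck≤k² = +-cancelˡ-≤ (2 * (μ * (μ + k))) (2 * (c * k)) (k * k) (begin
      2 * (μ * (μ + k)) + 2 * (c * k)   ≤⟨ +-monoˡ-≤ (2 * (c * k)) (*-monoʳ-≤ 2 (*-monoʳ-≤ μ X≤P+c)) ⟩
      2 * (μ * (P + c)) + 2 * (c * k)   ≡⟨ split-lhs P c μ k ⟨
      2 * (P * μ + c * (μ + k))         ≤⟨ gauss ⟩
      (μ + k) * (μ + k) + μ * μ         ≡⟨ split-rhs μ k ⟩
      2 * (μ * (μ + k)) + k * k         ∎)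
    k-cases : ∀ k′ → k′ ≡ k → ⊥
    k-cases zero refl = <⇒≱ (<-≤-trans μ<P (m≤m+n P c)) (*-cancelˡ-≤ μ {{ℕ.>-nonZero 0<μ}} (*-cancelˡ-≤ 2 (begin
      2 * (μ * (P + c))               ≡⟨ split-lhs-0 P c μ ⟩
      2 * (P * μ + c * (μ + 0))       ≤⟨ gauss ⟩
      (μ + 0) * (μ + 0) + μ * μ       ≡⟨ split-rhs μ 0 ⟩
      2 * (μ * (μ + 0)) + 0           ≡⟨ split-rhs-0 μ ⟩
      2 * (μ * μ)                     ∎)))
    k-cases (suc k′) refl = <⇒≱ k<2c (*-cancelˡ-≤ (suc k′) (begin
      suc k′ * (2 * c)                ≡⟨ twice-comm (suc k′) c ⟩
      2 * (c * suc k′)                ≤⟨ 2ck≤k² ⟩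
      suc k′ * suc k′                 ∎))
      where
      k<2c : suc k′ < 2 * c
      k<2c = +-cancelˡ-< μ (suc k′) (2 * c) (begin-strict
        μ + suc k′                    ≤⟨ X≤P+c ⟩
        P + c                         <⟨ +-monoˡ-< c P<μ+c ⟩
        μ + c + c                     ≡⟨ +twice μ c ⟩
        μ + 2 * c                     ∎)

∣re∣≡ℓ∞⇒∣im∣≡mᵍ : ∀ g → ∣ re g ∣ ≡ ℓ∞ g → ∣ im g ∣ ≡ mᵍ g
∣re∣≡ℓ∞⇒∣im∣≡mᵍ (mk x y) ∣x∣≡ℓ∞ = sym (m≥n⇒m⊓n≡n (≤-trans (m≤n⊔m ∣ x ∣ ∣ y ∣) (≤-reflexive (sym ∣x∣≡ℓ∞))))

IsUz⇒re≡ℓ∞ : ∀ {z u} → IsUz z u → re (u *ᵍ z) ≡ + ℓ∞ z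
IsUz⇒re≡ℓ∞ {z} (_ , ≢-case , ≡-case) with ℓ∞ z ≟ mᵍ z
... | no  ℓ≢m = ≢-case ℓ≢m
... | yes ℓ≡m = cong re (≡-case ℓ≡m)

IsUz⇒∣im∣≡mᵍ : ∀ {z u} → IsUz z u → ∣ im (u *ᵍ z) ∣ ≡ mᵍ z
IsUz⇒∣im∣≡mᵍ {z} {u} uz = trans (∣re∣≡ℓ∞⇒∣im∣≡mᵍ (u *ᵍ z) ∣re∣≡ℓ∞) (mᵍ-*unit (proj₁ uz) z)
  where
  ∣re∣≡ℓ∞ : ∣ re (u *ᵍ z) ∣ ≡ ℓ∞ (u *ᵍ z)
  ∣re∣≡ℓ∞ = trans (cong ∣_∣ (IsUz⇒re≡ℓ∞ uz)) (sym (ℓ∞-*unit (proj₁ uz) z))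

sgn-abs : ∀ y → y ≡ sgn y ℤ.* + ∣ y ∣
sgn-abs (+ zero)  = refl
sgn-abs (+ suc n) = sym (ℤP.*-identityˡ (+ suc n))
sgn-abs -[1+ n ]  = sym (ℤP.-1*i≡-i (+ suc n))

IsUz⇒normal : ∀ {z u} → IsUz z u → u *ᵍ z ≡ mk (+ ℓ∞ z) (sgn (im (u *ᵍ z)) ℤ.* + mᵍ z)
IsUz⇒normal {z} {u} uz = cong₂ mk (IsUz⇒re≡ℓ∞ uz)
  (trans (sgn-abs (im (u *ᵍ z))) (cong (λ n → sgn (im (u *ᵍ z)) ℤ.* + n) (IsUz⇒∣im∣≡mᵍ uz)))

opposite-signs : ∀ {y y′} → y ℤ.* y′ ℤ.< + 0 →
                 sgn y ≡ ℤ.- sgn y′ × ∣ sgn y′ ∣ ≡ 1 × sgn y′ ℤ.* sgn y′ ≡ + 1 × 0 < ∣ y ∣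
opposite-signs { -[1+ a ]} {+ suc c}  _   = refl , refl , refl , s≤s z≤n
opposite-signs {+ suc a}  { -[1+ c ]} _   = refl , refl , refl , s≤s z≤n
opposite-signs {+ a}      {+ c}      neg = ⊥-elim (n≮0 (ℤP.drop‿+<+ (subst (ℤ._< + 0) (sym (ℤP.pos-* a c)) neg)))
opposite-signs { -[1+ a ]} {+ zero}   neg = ⊥-elim (n≮0 (ℤP.drop‿+<+ (subst (ℤ._< + 0) (ℤP.*-zeroʳ -[1+ a ]) neg)))
opposite-signs {+ zero}   { -[1+ c ]} (ℤ.+<+ ())
opposite-signs { -[1+ a ]} { -[1+ c ]} (ℤ.+<+ ())

module RemainderShape {b r ub ur : 𝔾} (uzb : IsUz b ub) (uzr : IsUz r ur)
                      (opposite : im (ub *ᵍ b) ℤ.* im (ur *ᵍ r) ℤ.< + 0) where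

  s : ℤ
  s = sgn (im (ur *ᵍ r))

  Z : 𝔾
  Z = r -ᵍ iᵍ *ᵍ ub *ᵍ ι s *ᵍ conj ur *ᵍ b

  private
    signs : sgn (im (ub *ᵍ b)) ≡ ℤ.- s × ∣ s ∣ ≡ 1 × s ℤ.* s ≡ + 1 × 0 < ∣ im (ub *ᵍ b) ∣
    signs = opposite-signs {im (ub *ᵍ b)} {im (ur *ᵍ r)} opposite

    R≡ : ur *ᵍ r ≡ mk (+ ℓ∞ r) (s ℤ.* + mᵍ r)
    R≡ = IsUz⇒normal uzr

    B≡ : ub *ᵍ b ≡ mk (+ ℓ∞ b) (ℤ.- s ℤ.* + mᵍ b)
    B≡ = trans (IsUz⇒normal uzb) (cong (λ σ → mk (+ ℓ∞ b) (σ ℤ.* + mᵍ b)) (proj₁ signs))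

  0<mᵍb : 0 < mᵍ b
  0<mᵍb = subst (0 <_) (IsUz⇒∣im∣≡mᵍ uzb) (proj₂ (proj₂ (proj₂ signs)))

  cross-terms≤ : ℓ∞ r * mᵍ b + mᵍ r * ℓ∞ b ≤ ℓ∞ (r *ᵍ conj b)
  cross-terms≤ = begin
    P * μ + c * X                                       ≡⟨ ∣im∣≡ ⟨
    ∣ im ((ur *ᵍ r) *ᵍ conj (ub *ᵍ b)) ∣                 ≤⟨ m≤n⊔m _ _ ⟩
    ℓ∞ ((ur *ᵍ r) *ᵍ conj (ub *ᵍ b))                    ≡⟨ cong ℓ∞ rearrange ⟩
    ℓ∞ (conj ub *ᵍ (ur *ᵍ (r *ᵍ conj b)))               ≡⟨ ℓ∞-*unit (conj-unit (proj₁ uzb)) _ ⟩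
    ℓ∞ (ur *ᵍ (r *ᵍ conj b))                            ≡⟨ ℓ∞-*unit (proj₁ uzr) _ ⟩
    ℓ∞ (r *ᵍ conj b)                                    ∎
    where
    open ≤-Reasoning
    X μ P c : ℕ
    X = ℓ∞ b
    μ = mᵍ b
    P = ℓ∞ r
    c = mᵍ r
    im-product : ∀ P c X μ s → P ℤ.* ℤ.- (ℤ.- s ℤ.* μ) ℤ.+ s ℤ.* c ℤ.* X ≡ s ℤ.* (P ℤ.* μ ℤ.+ c ℤ.* X)
    im-product = ℤ-Solver.solve-∀
    ∣im∣≡ : ∣ im ((ur *ᵍ r) *ᵍ conj (ub *ᵍ b)) ∣ ≡ P * μ + c * X
    ∣im∣≡ = begin-equality
      ∣ im ((ur *ᵍ r) *ᵍ conj (ub *ᵍ b)) ∣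
        ≡⟨ cong₂ (λ R B → ∣ im (R *ᵍ conj B) ∣) R≡ B≡ ⟩
      ∣ im (mk (+ P) (s ℤ.* + c) *ᵍ conj (mk (+ X) (ℤ.- s ℤ.* + μ))) ∣
        ≡⟨ cong ∣_∣ (im-product (+ P) (+ c) (+ X) (+ μ) s) ⟩
      ∣ s ℤ.* (+ P ℤ.* + μ ℤ.+ + c ℤ.* + X) ∣
        ≡⟨ ℤP.abs-* s _ ⟩
      ∣ s ∣ * ∣ + P ℤ.* + μ ℤ.+ + c ℤ.* + X ∣
        ≡⟨ cong₂ _*_ (proj₁ (proj₂ signs)) (cong ∣_∣ pos-sum) ⟩
      1 * (P * μ + c * X)
        ≡⟨ *-identityˡ _ ⟩
      P * μ + c * X ∎
      where
      pos-sum : + P ℤ.* + μ ℤ.+ + c ℤ.* + X ≡ + (P * μ + c * X)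
      pos-sum = trans (cong₂ ℤ._+_ (sym (ℤP.pos-* P μ)) (sym (ℤP.pos-* c X))) (sym (ℤP.pos-+ (P * μ) (c * X)))
    rearrange : (ur *ᵍ r) *ᵍ conj (ub *ᵍ b) ≡ conj ub *ᵍ (ur *ᵍ (r *ᵍ conj b))
    rearrange = trans (cong ((ur *ᵍ r) *ᵍ_) (conj-* ub b)) (reassociate ur r (conj ub) (conj b))
      where
      reassociate : ∀ u r v′ b′ → (u *ᵍ r) *ᵍ (v′ *ᵍ b′) ≡ v′ *ᵍ (u *ᵍ (r *ᵍ b′))
      reassociate = solve-∀ 𝔾-ring

  gauss-inequality : 2 * ℓ∞ (r *ᵍ conj b) ≤ Nm b →
                     2 * (ℓ∞ r * mᵍ b + mᵍ r * ℓ∞ b) ≤ ℓ∞ b * ℓ∞ b + mᵍ b * mᵍ b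
  gauss-inequality bound = ≤-trans (*-monoʳ-≤ 2 cross-terms≤) (≤-trans bound (≤-reflexive (Nm≡ℓ∞²+mᵍ² b)))

  ur*Z≡ : ur *ᵍ Z ≡ mk (+ ℓ∞ r ℤ.- + mᵍ b) (s ℤ.* (+ mᵍ r ℤ.- + ℓ∞ b))
  ur*Z≡ = begin
    ur *ᵍ (r -ᵍ iᵍ *ᵍ ub *ᵍ ι s *ᵍ conj ur *ᵍ b)
      ≡⟨ expand ur (conj ur) r ub (ι s) b ⟩
    ur *ᵍ r -ᵍ (ur *ᵍ conj ur) *ᵍ (iᵍ *ᵍ ι s *ᵍ (ub *ᵍ b))
      ≡⟨ cong (λ u → ur *ᵍ r -ᵍ u *ᵍ (iᵍ *ᵍ ι s *ᵍ (ub *ᵍ b))) (unit*conj (proj₁ uzr)) ⟩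
    ur *ᵍ r -ᵍ 1ᵍ *ᵍ (iᵍ *ᵍ ι s *ᵍ (ub *ᵍ b))
      ≡⟨ cong (λ x → ur *ᵍ r -ᵍ x) (*ᵍ-identityˡ (iᵍ *ᵍ ι s *ᵍ (ub *ᵍ b))) ⟩
    ur *ᵍ r -ᵍ iᵍ *ᵍ ι s *ᵍ (ub *ᵍ b)
      ≡⟨ cong₂ (λ R B → R -ᵍ iᵍ *ᵍ ι s *ᵍ B) R≡ B≡ ⟩
    mk (+ P) (s ℤ.* + c) -ᵍ iᵍ *ᵍ ι s *ᵍ mk (+ X) (ℤ.- s ℤ.* + μ)
      ≡⟨ cong₂ mk (re-components (+ P) (+ c) (+ X) (+ μ) s) (im-components (+ P) (+ c) (+ X) (+ μ) s) ⟩
    mk (+ P ℤ.- s ℤ.* s ℤ.* + μ) (s ℤ.* (+ c ℤ.- + X))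
      ≡⟨ cong (λ σ → mk (+ P ℤ.- σ ℤ.* + μ) (s ℤ.* (+ c ℤ.- + X))) (proj₁ (proj₂ (proj₂ signs))) ⟩
    mk (+ P ℤ.- + 1 ℤ.* + μ) (s ℤ.* (+ c ℤ.- + X))
      ≡⟨ cong (λ m → mk (+ P ℤ.- m) (s ℤ.* (+ c ℤ.- + X))) (ℤP.*-identityˡ (+ μ)) ⟩
    mk (+ P ℤ.- + μ) (s ℤ.* (+ c ℤ.- + X)) ∎
    where
    open ≡-Reasoning
    X μ P c : ℕ
    X = ℓ∞ b
    μ = mᵍ b
    P = ℓ∞ r
    c = mᵍ r
    expand : ∀ u u′ r v σ b → u *ᵍ (r -ᵍ iᵍ *ᵍ v *ᵍ σ *ᵍ u′ *ᵍ b) ≡ u *ᵍ r -ᵍ (u *ᵍ u′) *ᵍ (iᵍ *ᵍ σ *ᵍ (v *ᵍ b))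
    expand = solve-∀ 𝔾-ring
    re-components : ∀ P c X μ s →
      P ℤ.- ((+ 0 ℤ.* s ℤ.- + 1 ℤ.* + 0) ℤ.* X ℤ.- (+ 0 ℤ.* + 0 ℤ.+ + 1 ℤ.* s) ℤ.* (ℤ.- s ℤ.* μ))
      ≡ P ℤ.- s ℤ.* s ℤ.* μ
    re-components = ℤ-Solver.solve-∀
    im-components : ∀ P c X μ s →
      s ℤ.* c ℤ.- ((+ 0 ℤ.* s ℤ.- + 1 ℤ.* + 0) ℤ.* (ℤ.- s ℤ.* μ) ℤ.+ (+ 0 ℤ.* + 0 ℤ.+ + 1 ℤ.* s) ℤ.* X)
      ≡ s ℤ.* (c ℤ.- X)
    im-components = ℤ-Solver.solve-∀

  Z-sizes : mᵍ b ≤ ℓ∞ r → mᵍ r ≤ ℓ∞ b → ℓ∞ r ∸ mᵍ b ≤ ℓ∞ b ∸ mᵍ r →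
            ℓ∞ Z ≡ ℓ∞ b ∸ mᵍ r × mᵍ Z ≡ ℓ∞ r ∸ mᵍ b
  Z-sizes μ≤P c≤X A≤C =
    trans (sym (ℓ∞-*unit (proj₁ uzr) Z)) (trans (cong₂ _⊔_ ∣re∣≡ ∣im∣≡) (m≤n⇒m⊔n≡n A≤C)) ,
    trans (sym (mᵍ-*unit (proj₁ uzr) Z)) (trans (cong₂ _⊓_ ∣re∣≡ ∣im∣≡) (m≤n⇒m⊓n≡m A≤C))
    where
    ∣re∣≡ : ∣ re (ur *ᵍ Z) ∣ ≡ ℓ∞ r ∸ mᵍ b
    ∣re∣≡ = trans (cong (∣_∣ ∘ re) ur*Z≡) (∣+n-+m∣≡n∸m μ≤P)
    ∣im∣≡ : ∣ im (ur *ᵍ Z) ∣ ≡ ℓ∞ b ∸ mᵍ r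
    ∣im∣≡ = begin
      ∣ im (ur *ᵍ Z) ∣                           ≡⟨ cong (∣_∣ ∘ im) ur*Z≡ ⟩
      ∣ s ℤ.* (+ mᵍ r ℤ.- + ℓ∞ b) ∣              ≡⟨ ℤP.abs-* s _ ⟩
      ∣ s ∣ * ∣ + mᵍ r ℤ.- + ℓ∞ b ∣              ≡⟨ cong₂ _*_ (proj₁ (proj₂ signs)) (∣+m-+n∣≡n∸m c≤X) ⟩
      1 * (ℓ∞ b ∸ mᵍ r)                          ≡⟨ *-identityˡ _ ⟩
      ℓ∞ b ∸ mᵍ r                                ∎
      where open ≡-Reasoning

module ShortExpansion {b r Z : 𝔾} {n′ k j : ℕ}
  (b≢0 : b ≢ 0ᵍ) (r≢0 : r ≢ 0ᵍ) (φb : Phi b (suc n′)) (φr : Phi r k) (v₂ : V₂ b j) (n≤k : suc n′ ≤ k)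
  (P+c<X : ℓ∞ r + mᵍ r < ℓ∞ b) (μ≤P : mᵍ b ≤ ℓ∞ r) (P<μ+c : ℓ∞ r < mᵍ b + mᵍ r)
  (ℓ∞Z≡ : ℓ∞ Z ≡ ℓ∞ b ∸ mᵍ r) (mᵍZ≡ : mᵍ Z ≡ ℓ∞ r ∸ mᵍ b) (C-bound : ℓ∞ b ∸ mᵍ r + 2 ^ suc j ≤ w n′)
  where

  private
    X μ P c A C : ℕ
    X = ℓ∞ b
    μ = mᵍ b
    P = ℓ∞ r
    c = mᵍ r
    A = P ∸ μ
    C = X ∸ c

    X≡C+c : X ≡ C + c
    X≡C+c = sym (m∸n+n≡m (≤-trans (m≤n+m c P) (<⇒≤ P+c<X)))

    P≡A+μ : P ≡ A + μ
    P≡A+μ = sym (m∸n+n≡m μ≤P)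

    P<C : P < C
    P<C = +-cancelʳ-< c P C (subst (P + c <_) X≡C+c P+c<X)

    ℓ₁Z<X : ℓ₁ Z < X
    ℓ₁Z<X = begin-strict
      ℓ₁ Z            ≡⟨ ℓ∞+mᵍ≡ℓ₁ Z ⟨
      ℓ∞ Z + mᵍ Z     ≡⟨ cong₂ _+_ ℓ∞Z≡ mᵍZ≡ ⟩
      C + A           <⟨ +-monoʳ-< C (+-cancelʳ-< μ A c (subst₂ _<_ P≡A+μ (+-comm μ c) P<μ+c)) ⟩
      C + c           ≡⟨ X≡C+c ⟨
      X               ∎
      where open ≤-Reasoning

    Z≢0 : Z ≢ 0ᵍ
    Z≢0 Z≡0 = <⇒≢ (≤-<-trans z≤n P<C) (trans (sym (cong ℓ∞ Z≡0)) ℓ∞Z≡)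

    2^j∣X : 2 ^ j ∣ X
    2^j∣X = proj₁ (ι∣ᵍ⇒ {2 ^ j} (proj₁ v₂))

    2^j∣μ : 2 ^ j ∣ μ
    2^j∣μ = proj₂ (ι∣ᵍ⇒ {2 ^ j} (proj₁ v₂))

    X-bound : X + 2 ^ suc j ≤ w (suc n′)
    X-bound = ℓ∞+2^suc≤w {j = j} (HasRep⇒HasPaddedRep (proj₁ φb)) b≢0 (proj₁ v₂)

    -- From X = C + c and P = A + μ: if 2ʲ⁺¹ divides A and C, then 2ʲ exactly divides r.
    r-has-short-rep : 2 ^ suc j ∣ A → 2 ^ suc j ∣ C → HasPaddedRep r n′
    r-has-short-rep 2^j+1∣A 2^j+1∣C =
      HasPaddedRep-if-small {t = j} r≡ odd ≤-refl 2^j∣X (subst (_< X) (ℓ∞+mᵍ≡ℓ₁ r) P+c<X) X-bound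
        (≤-trans (+-monoˡ-≤ (2 ^ suc j) (<⇒≤ P<C)) C-bound)
      where
      2^j∣2^j+1 : 2 ^ j ∣ 2 ^ suc j
      2^j∣2^j+1 = 2^∣2^ (n≤1+n j)
      2^j∣P : 2 ^ j ∣ P
      2^j∣P = subst (2 ^ j ∣_) (sym P≡A+μ) (ℕ∣.∣m∣n⇒∣m+n (ℕ∣.∣-trans 2^j∣2^j+1 2^j+1∣A) 2^j∣μ)
      2^j∣c : 2 ^ j ∣ c
      2^j∣c = ℕ∣.∣m+n∣m⇒∣n (subst (2 ^ j ∣_) X≡C+c 2^j∣X) (ℕ∣.∣-trans 2^j∣2^j+1 2^j+1∣C)
      g : 𝔾
      g = proj₁ (ι∣ᵍ⇐ {z = r} 2^j∣P 2^j∣c)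
      r≡ : r ≡ g *ᵍ ι (+ 2 ^ j)
      r≡ = proj₂ (ι∣ᵍ⇐ {z = r} 2^j∣P 2^j∣c)
      odd : 2∤ᵍ g
      odd 2∣g = proj₂ v₂ (ι∣ᵍ⇐ {z = b} 2^j+1∣X 2^j+1∣μ)
        where
        lift : ∀ {x} → 2 ∣ x → 2 ^ suc j ∣ x * 2 ^ j
        lift 2∣x = ℕ∣.*-pres-∣ 2∣x (ℕ∣.∣-refl {2 ^ j})
        2^j+1∣P : 2 ^ suc j ∣ P
        2^j+1∣P = subst (2 ^ suc j ∣_) (trans (sym (ℓ∞-*ι g (2 ^ j))) (cong ℓ∞ (sym r≡))) (lift (proj₁ (ι∣ᵍ⇒ {2} 2∣g)))
        2^j+1∣c : 2 ^ suc j ∣ c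
        2^j+1∣c = subst (2 ^ suc j ∣_) (trans (sym (mᵍ-*ι g (2 ^ j))) (cong mᵍ (sym r≡))) (lift (proj₂ (ι∣ᵍ⇒ {2} 2∣g)))
        2^j+1∣X : 2 ^ suc j ∣ X
        2^j+1∣X = subst (2 ^ suc j ∣_) (sym X≡C+c) (ℕ∣.∣m∣n⇒∣m+n 2^j+1∣C 2^j+1∣c)
        2^j+1∣μ : 2 ^ suc j ∣ μ
        2^j+1∣μ = ℕ∣.∣m+n∣m⇒∣n (subst (2 ^ suc j ∣_) P≡A+μ 2^j+1∣P) 2^j+1∣A

    from-decomposition : (∃ λ t → ∃ λ g → Z ≡ g *ᵍ ι (+ 2 ^ t) × 2∤ᵍ g) → ∃ λ k′ → k′ < suc n′ × Phi Z k′
    from-decomposition (t , g , Z≡ , odd) with t ≤? j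
    ... | yes t≤j =
      let (k′ , k′≤n′ , φ) = Phi-of-HasPaddedRep
            (HasPaddedRep-if-small {t = t} Z≡ odd t≤j 2^j∣X ℓ₁Z<X X-bound
              (subst (λ x → x + 2 ^ suc j ≤ w n′) (sym ℓ∞Z≡) C-bound)) Z≢0
      in k′ , s≤s k′≤n′ , φ
    ... | no t≰j = ⊥-elim (<-irrefl refl (≤-trans n≤k (Phi≤ φr (r-has-short-rep 2^j+1∣A 2^j+1∣C) r≢0)))
      where
      2^j+1∣2^t : 2 ^ suc j ∣ 2 ^ t
      2^j+1∣2^t = 2^∣2^ (≰⇒> t≰j)
      2^j+1∣A : 2 ^ suc j ∣ A
      2^j+1∣A = ℕ∣.∣-trans 2^j+1∣2^t (subst (2 ^ t ∣_) mᵍZ≡ (proj₂ (ι∣ᵍ⇒ {2 ^ t} (g , Z≡))))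
      2^j+1∣C : 2 ^ suc j ∣ C
      2^j+1∣C = ℕ∣.∣-trans 2^j+1∣2^t (subst (2 ^ t ∣_) ℓ∞Z≡ (proj₁ (ι∣ᵍ⇒ {2 ^ t} (g , Z≡))))

  φ-Z<n : ∃ λ k′ → k′ < suc n′ × Phi Z k′
  φ-Z<n = from-decomposition (2-adic Z≢0)

φ-drop : ∀ {b r Z n k j} → b ≢ 0ᵍ → r ≢ 0ᵍ → Phi b n → Phi r k → V₂ b j → n ≤ k →
         ℓ∞ r + mᵍ r < ℓ∞ b → mᵍ b ≤ ℓ∞ r → ℓ∞ r < mᵍ b + mᵍ r →
         ℓ∞ Z ≡ ℓ∞ b ∸ mᵍ r → mᵍ Z ≡ ℓ∞ r ∸ mᵍ b → ℓ∞ b ∸ mᵍ r + 2 ^ suc j ≤ W n →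
         ∃ λ k′ → k′ < n × Phi Z k′
φ-drop {r = r} {n = zero} {j = j} _ _ _ _ _ _ P+c<X _ _ _ _ C-bound =
  ⊥-elim (<⇒≱ (+-mono-≤ (m<n⇒0<n∸m (≤-<-trans (m≤n+m (mᵍ r) (ℓ∞ r)) P+c<X)) (*-monoʳ-≤ 2 (m^n>0 2 j))) C-bound)
φ-drop {n = suc n′} {j = j} b≢0 r≢0 φb φr v₂ n≤k P+c<X μ≤P P<μ+c ℓ∞Z≡ mᵍZ≡ C-bound =
  ShortExpansion.φ-Z<n {j = j} b≢0 r≢0 φb φr v₂ n≤k P+c<X μ≤P P<μ+c ℓ∞Z≡ mᵍZ≡ C-bound

+m-+n≤+o-+p⇒ : ∀ {m n o p} → n ≤ m → + m ℤ.- + n ℤ.≤ + o ℤ.- + p → m ∸ n + p ≤ o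
+m-+n≤+o-+p⇒ {m} {n} {o} {p} n≤m le = ℤP.drop‿+≤+ (begin
  + (m ∸ n + p)                ≡⟨ ℤP.pos-+ (m ∸ n) p ⟩
  + (m ∸ n) ℤ.+ + p            ≡⟨ cong (ℤ._+ + p) (trans (sym (ℤP.⊖-≥ n≤m)) (sym (ℤP.[+m]-[+n]≡m⊖n m n))) ⟩
  (+ m ℤ.- + n) ℤ.+ + p        ≤⟨ ℤP.+-monoˡ-≤ (+ p) le ⟩
  (+ o ℤ.- + p) ℤ.+ + p        ≡⟨ cancel (+ o) (+ p) ⟩
  + o                          ∎)
  where
  open ℤP.≤-Reasoning
  cancel : ∀ o p → (o ℤ.- p) ℤ.+ p ≡ o
  cancel = ℤ-Solver.solve-∀

lemma10 : (a b : 𝔾) → a ≢ 0ᵍ → b ≢ 0ᵍ → gaussRem a b ≢ 0ᵍ →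
  (ub ur : 𝔾) → IsUz b ub → IsUz (gaussRem a b) ur →
  (n k j : ℕ) → Phi b n → Phi (gaussRem a b) k → V₂ b j →
  im (ub *ᵍ b) ℤ.* im (ur *ᵍ gaussRem a b) ℤ.< + 0 →
  n ℕ.≤ k →
  mᵍ b ℕ.< ℓ∞ (gaussRem a b) →
  ℓ∞ (gaussRem a b) ℕ.< mᵍ b ℕ.+ mᵍ (gaussRem a b) →
  + ℓ∞ b ℤ.- + mᵍ (gaussRem a b) ℤ.≤ + W n ℤ.- + (2 ^ suc j) →
  Σ ℕ λ k′ → (k′ ℕ.< n) × Phi (gaussRem a b -ᵍ
    iᵍ *ᵍ ub *ᵍ ι (sgn (im (ur *ᵍ gaussRem a b))) *ᵍ conj ur *ᵍ b) k′
lemma10 a b _ b≢0 r≢0 ub ur uzb uzr n k j φb φr v₂ opposite n≤k μ<P P<μ+c C-bound =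
  φ-drop {j = j} b≢0 r≢0 φb φr v₂ n≤k P+c<X μ≤P P<μ+c (proj₁ sizes) (proj₂ sizes)
         (+m-+n≤+o-+p⇒ c≤X C-bound)
  where
  open RemainderShape uzb uzr opposite
  r : 𝔾
  r = gaussRem a b
  μ≤P : mᵍ b ≤ ℓ∞ r
  μ≤P = <⇒≤ μ<P
  P+c<X : ℓ∞ r + mᵍ r < ℓ∞ b
  P+c<X = ℓ∞-gap 0<mᵍb (mᵍ≤ℓ∞ b) μ<P P<μ+c (gauss-inequality (gaussRem-bound a b b≢0))
  c≤X : mᵍ r ≤ ℓ∞ b
  c≤X = ≤-trans (m≤n+m (mᵍ r) (ℓ∞ r)) (<⇒≤ P+c<X)
  A≤C : ℓ∞ r ∸ mᵍ b ≤ ℓ∞ b ∸ mᵍ r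
  A≤C = ≤-trans (m∸n≤m (ℓ∞ r) (mᵍ b)) (m+n≤o⇒m≤o∸n (ℓ∞ r) (<⇒≤ P+c<X))
  sizes : ℓ∞ Z ≡ ℓ∞ b ∸ mᵍ r × mᵍ Z ≡ ℓ∞ r ∸ mᵍ b
  sizes = Z-sizes μ≤P c≤X A≤C
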